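{- Let $\exists\alpha\,A$ be a closed formula. Suppose $\Gamma\vdash t:\exists\alpha\,A$ in $\mathsf{IL}+\mathsf{EM}_1^-$ for a quasi-closed proof term $t$, and $t\mapsto^* t'$ with $t'$ in normal form. Then $\Gamma\vdash t':\exists\alpha\,A$ and $t'$ is a Herbrand normal form $$((\dots((m_0,u_0)\mid(m_1,u_1))\mid\dots)\mid(m_k,u_k)).$$ Moreover, $\Gamma\vdash A[m_0/\alpha]\lor\dots\lor A[m_k/\alpha]$ is derivable in $\mathsf{IL}+\mathsf{EM}_1^-$.
   Context: Fix a first-order language $\mathcal{L}$; formulas are built from atomic formulas and $\bot$ with $\land,\lor,\rightarrow,\forall,\exists$, $\lnot A:=A\rightarrow\bot$. A propositional formula is quantifier-free; it is negative if $\lor$ does not occur in it; a simply universal formula is one of the form $\forall\alpha_1\dots\forall\alpha_k P$ with $P$ negative propositional. Proof terms of $\mathsf{IL}+\mathsf{EM}_1^-$: $t,u,v::= x\mid tu\mid tm\mid\lambda x.u\mid\lambda\alpha.u\mid\langle t,u\rangle\mid\pi_0u\mid\pi_1u\mid\iota_0(u)\mid\iota_1(u)\mid t[x.u,y.v]\mid(m,t)\mid t[(\alpha,x).u]\mid (u\mid v)\mid (u\parallel_a v)\mid \mathsf{H}_a^{\alpha A}\mid \mathsf{W}_a^{\alpha P}\mid \mathsf{H}_0^{P}$, with $m$ first-order terms, $x,y$ proof variables, $a$ hypothesis variables, $\alpha$ first-order variables, $A$ negative propositional or simply universal, $P$ negative propositional. Judgments $\Gamma\vdash t:A$, $\Gamma$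 a list of distinct (proof or hypothesis) variables with formulas, are generated by the usual intuitionistic rules: $\Gamma,x:A\vdash x:A$; $\langle u,t\rangle:A\land B$ from $u:A,t:B$; $\pi_0u:A$, $\pi_1u:B$ from $u:A\land B$; $tu:B$ from $t:A\rightarrow B,u:A$; $\lambda x.u:A\rightarrow B$ from $\Gamma,x:A\vdash u:B$; $\iota_0(u):A\lor B$ from $u:A$, $\iota_1(u):A\lor B$ from $u:B$; $u[x.w_1,y.w_2]:C$ from $u:A\lor B$, $\Gamma,x:A\vdash w_1:C$, $\Gamma,y:B\vdash w_2:C$; $um:A[m/\alpha]$ from $u:\forall\alpha A$; $\lambda\alpha.u:\forall\alpha A$ from $u:A$ ($\alpha$ not free in $\Gamma$); $(m,u):\exists\alpha A$ from $u:A[m/\alpha]$; $u[(\alpha,x).t]:C$ from $u:\exists\alpha A$ and $\Gamma,x:A\vdash t:C$ ($\alpha$ not free in $C,\Gamma$); plus the axioms $\Gamma,a:\forall\alpha A\vdash\mathsf{H}_a^{\alpha A}:\forall\alpha A$; $\Gamma,a:\exists\alpha P\vdash\mathsf{W}_a^{\alpha P}:\exists\alpha P$; $\Gamma,a:P\vdash\mathsf{H}_0^P:P$; $\Gamma\vdash\mathsf{H}_0^{\bot\rightarrow P}:\bot\rightarrow P$; the rule $\mathsf{EM}_0$: from $\Gamma,a:\lnot P\vdash u:C$ and $\Gamma,a:P\vdash v:C$ ($P$ negative propositional) infer $\Gamma\vdash (u\mid v):C$; and the rule $\mathsf{EM}_1^-$: from $\Gamma,a:\forall\alpha P\vdash u:\exists\beta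 Q$ and $\Gamma,a:\exists\alpha\lnot P\vdash v:\exists\beta Q$ ($P,Q$ negative propositional) infer $\Gamma\vdash(u\parallel_a v):\exists\beta Q$; in $u\parallel_a v$ the variable $a$ is bound, its free occurrences in $u$ are all within subterms $\mathsf{H}_a^{\alpha P}$ and in $v$ within subterms $\mathsf{W}_a^{\alpha\lnot P}$. Exception substitution: $v[a:=m]$ replaces each free $\mathsf{W}_a^{\alpha\lnot P}$ in $v$ by $(m,\mathsf{H}_0^{\lnot P[m/\alpha]})$; $u[a:=m]$ replaces each subterm $\mathsf{H}_a^{\alpha P}m$ (free $a$) of $u$ by $\mathsf{H}_0^{P[m/\alpha]}$. A subterm $\mathsf{H}_a^{\alpha P}m$ is active if its only free variable is $a$. Reduction rules (applicable to any subterm): $(\lambda x.u)t\mapsto u[t/x]$; $(\lambda\alpha.u)m\mapsto u[m/\alpha]$; $\pi_i\langle u_0,u_1\rangle\mapsto u_i$; $\iota_i(u)[x_0.t_0,x_1.t_1]\mapsto t_i[u/x_i]$; $(m,u)[(\alpha,x).v]\mapsto v[m/\alpha][u/x]$; permutations $(u\mid v)w\mapsto (uw\mid vw)$ ($w$ a proof term or first-order term), $\pi_i(u\mid v)\mapsto(\pi_iu\mid\pi_iv)$, $(u\mid v)[x.w_1,y.w_2]\mapsto(u[x.w_1,y.w_2]\mid v[x.w_1,y.w_2])$, $(u\mid v)[(\alpha,x).w]\mapsto(u[(\alpha,x).w]\mid v[(\alpha,x).w])$; $u\parallel_a v\mapsto u$ if $a$ is not free in $u$; $u\parallel_a v\mapsto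 (v[a:=m]\mid (u[a:=m]\parallel_a v))$ whenever $u$ has an active subterm $\mathsf{H}_a^{\alpha P}m$. A term is in normal form if it contains no redex; $\mapsto^*$ is the reflexive-transitive closure of $\mapsto$. A proof term is quasi-closed if its only free variables are hypothesis variables $a_1,\dots,a_n$, each occurrence of which is of the form $\mathsf{H}_{a_i}^{\vec\alpha P_i}$ with $\forall\vec\alpha\,P_i$ simply universal. Herbrand normal forms are defined inductively: every normal term $(m,u)$ is one, and if $u,v$ are Herbrand normal forms then so is $(u\mid v)$. -}

module Defs where

open import Data.Nat using (ℕ; zero; suc; _<_; pred)
open import Data.Vec using (Vec; []; _∷_)
open import Data.List using (List; []; _∷_; _++_; map; [_])
open import Data.List.Membership.Propositional using (_∈_)
open import Data.Product using (Σ; _×_; _,_)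
open import Data.Sum using (_⊎_)
open import Data.Empty using (⊥)
open import Relation.Nullary using (¬_)
open import Relation.Binary.PropositionalEquality using (_≡_)
open import Relation.Binary.Construct.Closure.ReflexiveTransitive using (Star)

record Signature : Set₁ where
  field
    Func   : Set
    farity : Func → ℕ
    Pred   : Set
    parity : Pred → ℕ

module Syntax (L : Signature) where
  open Signature L

  data Tm : Set where
    var : ℕ → Tm
    fun : (f : Func) → Vec Tm (farity f) → Tm

  infixr 6 _∧f_
  infixr 5 _∨f_
  infixr 4 _⇒f_

  data Fm : Set where
    atom : (p : Pred) → Vec Tm (parity p) → Fm
    ⊥f   : Fm
    _∧f_ : Fm → Fm → Fm
    _∨f_ : Fm → Fm → Fm
    _⇒f_ : Fm → Fm → Fm
    ∀f   : Fm → Fm        -- ∀α A, α is index 0 in A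
    ∃f   : Fm → Fm        -- ∃α A, α is index 0 in A

  ¬f : Fm → Fm
  ¬f A = A ⇒f ⊥f

  ext : (ℕ → ℕ) → ℕ → ℕ
  ext ρ zero    = zero
  ext ρ (suc n) = suc (ρ n)

  renT : (ℕ → ℕ) → Tm → Tm
  renV : ∀ {n} → (ℕ → ℕ) → Vec Tm n → Vec Tm n
  renT ρ (var n)    = var (ρ n)
  renT ρ (fun f ts) = fun f (renV ρ ts)
  renV ρ []         = []
  renV ρ (t ∷ ts)   = renT ρ t ∷ renV ρ ts

  exts : (ℕ → Tm) → ℕ → Tm
  exts σ zero    = var zero
  exts σ (suc n) = renT suc (σ n)

  subT : (ℕ → Tm) → Tm → Tm
  subV : ∀ {n} → (ℕ → Tm) → Vec Tm n → Vec Tm n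
  subT σ (var n)    = σ n
  subT σ (fun f ts) = fun f (subV σ ts)
  subV σ []         = []
  subV σ (t ∷ ts)   = subT σ t ∷ subV σ ts

  renF : (ℕ → ℕ) → Fm → Fm
  renF ρ (atom p ts) = atom p (renV ρ ts)
  renF ρ ⊥f          = ⊥f
  renF ρ (A ∧f B)    = renF ρ A ∧f renF ρ B
  renF ρ (A ∨f B)    = renF ρ A ∨f renF ρ B
  renF ρ (A ⇒f B)    = renF ρ A ⇒f renF ρ B
  renF ρ (∀f A)      = ∀f (renF (ext ρ) A)
  renF ρ (∃f A)      = ∃f (renF (ext ρ) A)

  subF : (ℕ → Tm) → Fm → Fm
  subF σ (atom p ts) = atom p (subV σ ts)
  subF σ ⊥f          = ⊥f
  subF σ (A ∧f B)    = subF σ A ∧f subF σ B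
  subF σ (A ∨f B)    = subF σ A ∨f subF σ B
  subF σ (A ⇒f B)    = subF σ A ⇒f subF σ B
  subF σ (∀f A)      = ∀f (subF (exts σ) A)
  subF σ (∃f A)      = ∃f (subF (exts σ) A)

  _•_ : Tm → (ℕ → Tm) → ℕ → Tm
  (m • σ) zero    = m
  (m • σ) (suc n) = σ n

  -- A[m/α] where A is the body of ∀α A / ∃α A
  _[_]F : Fm → Tm → Fm
  A [ m ]F = subF (m • var) A

  occT : ℕ → Tm → Set
  occV : ∀ {k} → ℕ → Vec Tm k → Set
  occT n (var k)    = n ≡ k
  occT n (fun f ts) = occV n ts
  occV n []         = ⊥
  occV n (t ∷ ts)   = occT n t ⊎ occV n ts

  occF : ℕ → Fm → Set
  occF n (atom p ts) = occV n ts
  occF n ⊥f          = ⊥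
  occF n (A ∧f B)    = occF n A ⊎ occF n B
  occF n (A ∨f B)    = occF n A ⊎ occF n B
  occF n (A ⇒f B)    = occF n A ⊎ occF n B
  occF n (∀f A)      = occF (suc n) A
  occF n (∃f A)      = occF (suc n) A

  ClosedT : Tm → Set
  ClosedT m = ∀ n → ¬ occT n m

  ClosedF : Fm → Set
  ClosedF A = ∀ n → ¬ occF n A

  BoundT : ℕ → Tm → Set
  BoundT d m = ∀ n → occT n m → n < d

  BoundF : ℕ → Fm → Set
  BoundF d A = ∀ n → occF n A → n < d

  data NegProp : Fm → Set where
    np-atom : ∀ {p ts} → NegProp (atom p ts)
    np-⊥    : NegProp ⊥f
    np-∧    : ∀ {A B} → NegProp A → NegProp B → NegProp (A ∧f B)
    np-⇒    : ∀ {A B} → NegProp A → NegProp B → NegProp (A ⇒f B)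

  data SimplyUniversal : Fm → Set where
    su-base : ∀ {P} → NegProp P → SimplyUniversal P
    su-∀    : ∀ {A} → SimplyUniversal A → SimplyUniversal (∀f A)

  -- Proof terms. Proof variables and hypothesis variables share one
  -- de Bruijn index space (positions in the context Γ).

  infixl 9 _·_ _·ₘ_

  data PT : Set where
    pv     : ℕ → PT
    _·_    : PT → PT → PT
    _·ₘ_   : PT → Tm → PT
    ƛ      : PT → PT
    Λ      : PT → PT
    ⟨_,_⟩  : PT → PT → PT
    π₀     : PT → PT
    π₁     : PT → PT
    ι₀     : PT → PT
    ι₁     : PT → PT
    case   : PT → PT → PT → PT      -- t[x.u, y.v]  (x, y bound in u, v)
    pair   : Tm → PT → PT
    unpack : PT → PT → PT           -- t[(α,x).u]   (α, x bound in u)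
    em0    : PT → PT → PT           -- (u | v)
    em1    : PT → PT → PT           -- (u ∥_a v)    (a bound in u and v)
    Hyp    : ℕ → Fm → PT            -- H_a^{αA}  (A the body, α index 0)
    Wit    : ℕ → Fm → PT            -- W_a^{αP}  (P the body, α index 0)
    H0     : Fm → PT

  -- Contexts and typing

  data Entry : Set where
    prf : Fm → Entry
    hyp : Fm → Entry

  Ctx : Set
  Ctx = List Entry

  renE : (ℕ → ℕ) → Entry → Entry
  renE ρ (prf A) = prf (renF ρ A)
  renE ρ (hyp A) = hyp (renF ρ A)

  -- weaken a context under a first-order binder (α not free in Γ)
  ⇑ : Ctx → Ctx
  ⇑ Γ = map (renE suc) Γ

  data _∋_⦂_ : Ctx → ℕ → Entry → Set where
    here  : ∀ {Γ e} → (e ∷ Γ) ∋ zero ⦂ e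
    there : ∀ {Γ e e' i} → Γ ∋ i ⦂ e → (e' ∷ Γ) ∋ suc i ⦂ e

  infix 3 _⊢_⦂_

  -- The hypothesis introduced by EM₀ is never referred to by name (only via
  -- H₀), so it is appended at the end of Γ (no reindexing needed).
  data _⊢_⦂_ : Ctx → PT → Fm → Set where
    ax     : ∀ {Γ i A} → Γ ∋ i ⦂ prf A → Γ ⊢ pv i ⦂ A
    ∧I     : ∀ {Γ u t A B} → Γ ⊢ u ⦂ A → Γ ⊢ t ⦂ B → Γ ⊢ ⟨ u , t ⟩ ⦂ A ∧f B
    ∧E₀    : ∀ {Γ u A B} → Γ ⊢ u ⦂ A ∧f B → Γ ⊢ π₀ u ⦂ A
    ∧E₁    : ∀ {Γ u A B} → Γ ⊢ u ⦂ A ∧f B → Γ ⊢ π₁ u ⦂ B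
    ⇒E     : ∀ {Γ t u A B} → Γ ⊢ t ⦂ A ⇒f B → Γ ⊢ u ⦂ A → Γ ⊢ t · u ⦂ B
    ⇒I     : ∀ {Γ u A B} → (prf A ∷ Γ) ⊢ u ⦂ B → Γ ⊢ ƛ u ⦂ A ⇒f B
    ∨I₀    : ∀ {Γ u A B} → Γ ⊢ u ⦂ A → Γ ⊢ ι₀ u ⦂ A ∨f B
    ∨I₁    : ∀ {Γ u A B} → Γ ⊢ u ⦂ B → Γ ⊢ ι₁ u ⦂ A ∨f B
    ∨E     : ∀ {Γ u w₁ w₂ A B C} → Γ ⊢ u ⦂ A ∨f B → (prf A ∷ Γ) ⊢ w₁ ⦂ C →
             (prf B ∷ Γ) ⊢ w₂ ⦂ C → Γ ⊢ case u w₁ w₂ ⦂ C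
    ∀E     : ∀ {Γ u A} (m : Tm) → Γ ⊢ u ⦂ ∀f A → Γ ⊢ u ·ₘ m ⦂ A [ m ]F
    ∀I     : ∀ {Γ u A} → ⇑ Γ ⊢ u ⦂ A → Γ ⊢ Λ u ⦂ ∀f A
    ∃I     : ∀ {Γ u A} (m : Tm) → Γ ⊢ u ⦂ A [ m ]F → Γ ⊢ pair m u ⦂ ∃f A
    ∃E     : ∀ {Γ u t A C} → Γ ⊢ u ⦂ ∃f A → (prf A ∷ ⇑ Γ) ⊢ t ⦂ renF suc C →
             Γ ⊢ unpack u t ⦂ C
    H-ax   : ∀ {Γ i A} → SimplyUniversal A → Γ ∋ i ⦂ hyp (∀f A) → Γ ⊢ Hyp i A ⦂ ∀f A
    W-ax   : ∀ {Γ i P} → NegProp P → Γ ∋ i ⦂ hyp (∃f P) → Γ ⊢ Wit i P ⦂ ∃f P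
    H0-ax  : ∀ {Γ P} → NegProp P → hyp P ∈ Γ → Γ ⊢ H0 P ⦂ P
    H0-efq : ∀ {Γ P} → NegProp P → Γ ⊢ H0 (⊥f ⇒f P) ⦂ ⊥f ⇒f P
    EM0    : ∀ {Γ u v P C} → NegProp P → (Γ ++ [ hyp (¬f P) ]) ⊢ u ⦂ C →
             (Γ ++ [ hyp P ]) ⊢ v ⦂ C → Γ ⊢ em0 u v ⦂ C
    EM1    : ∀ {Γ u v P Q} → NegProp P → NegProp Q →
             (hyp (∀f P) ∷ Γ) ⊢ u ⦂ ∃f Q → (hyp (∃f (¬f P)) ∷ Γ) ⊢ v ⦂ ∃f Q →
             Γ ⊢ em1 u v ⦂ ∃f Q

  -- Operations on proof terms

  renFO : (ℕ → ℕ) → PT → PT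
  renFO ρ (pv i)         = pv i
  renFO ρ (t · s)        = renFO ρ t · renFO ρ s
  renFO ρ (t ·ₘ m)       = renFO ρ t ·ₘ renT ρ m
  renFO ρ (ƛ t)          = ƛ (renFO ρ t)
  renFO ρ (Λ t)          = Λ (renFO (ext ρ) t)
  renFO ρ ⟨ t , s ⟩      = ⟨ renFO ρ t , renFO ρ s ⟩
  renFO ρ (π₀ t)         = π₀ (renFO ρ t)
  renFO ρ (π₁ t)         = π₁ (renFO ρ t)
  renFO ρ (ι₀ t)         = ι₀ (renFO ρ t)
  renFO ρ (ι₁ t)         = ι₁ (renFO ρ t)
  renFO ρ (case t s r)   = case (renFO ρ t) (renFO ρ s) (renFO ρ r)
  renFO ρ (pair m t)     = pair (renT ρ m) (renFO ρ t)
  renFO ρ (unpack t s)   = unpack (renFO ρ t) (renFO (ext ρ) s)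
  renFO ρ (em0 t s)      = em0 (renFO ρ t) (renFO ρ s)
  renFO ρ (em1 t s)      = em1 (renFO ρ t) (renFO ρ s)
  renFO ρ (Hyp i A)      = Hyp i (renF (ext ρ) A)
  renFO ρ (Wit i P)      = Wit i (renF (ext ρ) P)
  renFO ρ (H0 P)         = H0 (renF ρ P)

  subFO : (ℕ → Tm) → PT → PT
  subFO σ (pv i)         = pv i
  subFO σ (t · s)        = subFO σ t · subFO σ s
  subFO σ (t ·ₘ m)       = subFO σ t ·ₘ subT σ m
  subFO σ (ƛ t)          = ƛ (subFO σ t)
  subFO σ (Λ t)          = Λ (subFO (exts σ) t)
  subFO σ ⟨ t , s ⟩      = ⟨ subFO σ t , subFO σ s ⟩
  subFO σ (π₀ t)         = π₀ (subFO σ t)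
  subFO σ (π₁ t)         = π₁ (subFO σ t)
  subFO σ (ι₀ t)         = ι₀ (subFO σ t)
  subFO σ (ι₁ t)         = ι₁ (subFO σ t)
  subFO σ (case t s r)   = case (subFO σ t) (subFO σ s) (subFO σ r)
  subFO σ (pair m t)     = pair (subT σ m) (subFO σ t)
  subFO σ (unpack t s)   = unpack (subFO σ t) (subFO (exts σ) s)
  subFO σ (em0 t s)      = em0 (subFO σ t) (subFO σ s)
  subFO σ (em1 t s)      = em1 (subFO σ t) (subFO σ s)
  subFO σ (Hyp i A)      = Hyp i (subF (exts σ) A)
  subFO σ (Wit i P)      = Wit i (subF (exts σ) P)
  subFO σ (H0 P)         = H0 (subF σ P)

  renPV : (ℕ → ℕ) → PT → PT
  renPV ρ (pv i)         = pv (ρ i)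
  renPV ρ (t · s)        = renPV ρ t · renPV ρ s
  renPV ρ (t ·ₘ m)       = renPV ρ t ·ₘ m
  renPV ρ (ƛ t)          = ƛ (renPV (ext ρ) t)
  renPV ρ (Λ t)          = Λ (renPV ρ t)
  renPV ρ ⟨ t , s ⟩      = ⟨ renPV ρ t , renPV ρ s ⟩
  renPV ρ (π₀ t)         = π₀ (renPV ρ t)
  renPV ρ (π₁ t)         = π₁ (renPV ρ t)
  renPV ρ (ι₀ t)         = ι₀ (renPV ρ t)
  renPV ρ (ι₁ t)         = ι₁ (renPV ρ t)
  renPV ρ (case t s r)   = case (renPV ρ t) (renPV (ext ρ) s) (renPV (ext ρ) r)
  renPV ρ (pair m t)     = pair m (renPV ρ t)
  renPV ρ (unpack t s)   = unpack (renPV ρ t) (renPV (ext ρ) s)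
  renPV ρ (em0 t s)      = em0 (renPV ρ t) (renPV ρ s)
  renPV ρ (em1 t s)      = em1 (renPV (ext ρ) t) (renPV (ext ρ) s)
  renPV ρ (Hyp i A)      = Hyp (ρ i) A
  renPV ρ (Wit i P)      = Wit (ρ i) P
  renPV ρ (H0 P)         = H0 P

  -- removing index k: is i the removed index, or which index does it become?
  data Look : Set where
    hit  : Look
    keep : ℕ → Look

  look : ℕ → ℕ → Look
  look zero    zero    = hit
  look zero    (suc i) = keep i
  look (suc k) zero    = keep zero
  look (suc k) (suc i) with look k i
  ... | hit    = hit
  ... | keep j = keep (suc j)

  lowerIdx : ℕ → ℕ → ℕ
  lowerIdx k i with look k i
  ... | hit    = i
  ... | keep j = j

  -- t[u/x] where x is index k (u already lives at the depth of t)
  substPV : ℕ → PT → PT → PT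
  substPV k u (pv i) with look k i
  ... | hit    = u
  ... | keep j = pv j
  substPV k u (t · s)      = substPV k u t · substPV k u s
  substPV k u (t ·ₘ m)     = substPV k u t ·ₘ m
  substPV k u (ƛ t)        = ƛ (substPV (suc k) (renPV suc u) t)
  substPV k u (Λ t)        = Λ (substPV k (renFO suc u) t)
  substPV k u ⟨ t , s ⟩    = ⟨ substPV k u t , substPV k u s ⟩
  substPV k u (π₀ t)       = π₀ (substPV k u t)
  substPV k u (π₁ t)       = π₁ (substPV k u t)
  substPV k u (ι₀ t)       = ι₀ (substPV k u t)
  substPV k u (ι₁ t)       = ι₁ (substPV k u t)
  substPV k u (case t s r) = case (substPV k u t) (substPV (suc k) (renPV suc u) s)
                                  (substPV (suc k) (renPV suc u) r)
  substPV k u (pair m t)   = pair m (substPV k u t)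
  substPV k u (unpack t s) = unpack (substPV k u t)
                                    (substPV (suc k) (renPV suc (renFO suc u)) s)
  substPV k u (em0 t s)    = em0 (substPV k u t) (substPV k u s)
  substPV k u (em1 t s)    = em1 (substPV (suc k) (renPV suc u) t)
                                 (substPV (suc k) (renPV suc u) s)
  substPV k u (Hyp i A)    = Hyp (lowerIdx k i) A
  substPV k u (Wit i P)    = Wit (lowerIdx k i) P
  substPV k u (H0 P)       = H0 P

  -- v[a:=m] (a is index k; the binder of a is removed): every free
  -- W_a^{αP} becomes (m, H_0^{P[m/α]})
  exW : ℕ → Tm → PT → PT
  exW k m (pv i)         = pv (lowerIdx k i)
  exW k m (t · s)        = exW k m t · exW k m s
  exW k m (t ·ₘ n)       = exW k m t ·ₘ n
  exW k m (ƛ t)          = ƛ (exW (suc k) m t)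
  exW k m (Λ t)          = Λ (exW k (renT suc m) t)
  exW k m ⟨ t , s ⟩      = ⟨ exW k m t , exW k m s ⟩
  exW k m (π₀ t)         = π₀ (exW k m t)
  exW k m (π₁ t)         = π₁ (exW k m t)
  exW k m (ι₀ t)         = ι₀ (exW k m t)
  exW k m (ι₁ t)         = ι₁ (exW k m t)
  exW k m (case t s r)   = case (exW k m t) (exW (suc k) m s) (exW (suc k) m r)
  exW k m (pair n t)     = pair n (exW k m t)
  exW k m (unpack t s)   = unpack (exW k m t) (exW (suc k) (renT suc m) s)
  exW k m (em0 t s)      = em0 (exW k m t) (exW k m s)
  exW k m (em1 t s)      = em1 (exW (suc k) m t) (exW (suc k) m s)
  exW k m (Hyp i A)      = Hyp (lowerIdx k i) A
  exW k m (Wit i P) with look k i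
  ... | hit    = pair m (H0 (P [ m ]F))
  ... | keep j = Wit j P
  exW k m (H0 P)         = H0 P

  -- u[a:=m] (a is index k; the binder of a stays): every subterm
  -- H_a^{αP} m becomes H_0^{P[m/α]}. Given as a (total, functional) relation.
  data ExH : ℕ → Tm → PT → PT → Set where
    ex-hit  : ∀ {k m P} → ExH k m (Hyp k P ·ₘ m) (H0 (P [ m ]F))
    ex-appₘ : ∀ {k m t t' n} → (∀ P → t ≡ Hyp k P → ¬ (n ≡ m)) →
              ExH k m t t' → ExH k m (t ·ₘ n) (t' ·ₘ n)
    ex-pv   : ∀ {k m i} → ExH k m (pv i) (pv i)
    ex-app  : ∀ {k m t t' s s'} → ExH k m t t' → ExH k m s s' → ExH k m (t · s) (t' · s')
    ex-ƛ    : ∀ {k m t t'} → ExH (suc k) m t t' → ExH k m (ƛ t) (ƛ t')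
    ex-Λ    : ∀ {k m t t'} → ExH k (renT suc m) t t' → ExH k m (Λ t) (Λ t')
    ex-⟨⟩   : ∀ {k m t t' s s'} → ExH k m t t' → ExH k m s s' →
              ExH k m ⟨ t , s ⟩ ⟨ t' , s' ⟩
    ex-π₀   : ∀ {k m t t'} → ExH k m t t' → ExH k m (π₀ t) (π₀ t')
    ex-π₁   : ∀ {k m t t'} → ExH k m t t' → ExH k m (π₁ t) (π₁ t')
    ex-ι₀   : ∀ {k m t t'} → ExH k m t t' → ExH k m (ι₀ t) (ι₀ t')
    ex-ι₁   : ∀ {k m t t'} → ExH k m t t' → ExH k m (ι₁ t) (ι₁ t')
    ex-case : ∀ {k m t t' s s' r r'} → ExH k m t t' → ExH (suc k) m s s' →
              ExH (suc k) m r r' → ExH k m (case t s r) (case t' s' r')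
    ex-pair : ∀ {k m n t t'} → ExH k m t t' → ExH k m (pair n t) (pair n t')
    ex-unp  : ∀ {k m t t' s s'} → ExH k m t t' → ExH (suc k) (renT suc m) s s' →
              ExH k m (unpack t s) (unpack t' s')
    ex-em0  : ∀ {k m t t' s s'} → ExH k m t t' → ExH k m s s' →
              ExH k m (em0 t s) (em0 t' s')
    ex-em1  : ∀ {k m t t' s s'} → ExH (suc k) m t t' → ExH (suc k) m s s' →
              ExH k m (em1 t s) (em1 t' s')
    ex-Hyp  : ∀ {k m i A} → ExH k m (Hyp i A) (Hyp i A)
    ex-Wit  : ∀ {k m i P} → ExH k m (Wit i P) (Wit i P)
    ex-H0   : ∀ {k m P} → ExH k m (H0 P) (H0 P)

  Free : ℕ → PT → Set
  Free k (pv i)         = i ≡ k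
  Free k (t · s)        = Free k t ⊎ Free k s
  Free k (t ·ₘ m)       = Free k t
  Free k (ƛ t)          = Free (suc k) t
  Free k (Λ t)          = Free k t
  Free k ⟨ t , s ⟩      = Free k t ⊎ Free k s
  Free k (π₀ t)         = Free k t
  Free k (π₁ t)         = Free k t
  Free k (ι₀ t)         = Free k t
  Free k (ι₁ t)         = Free k t
  Free k (case t s r)   = Free k t ⊎ (Free (suc k) s ⊎ Free (suc k) r)
  Free k (pair m t)     = Free k t
  Free k (unpack t s)   = Free k t ⊎ Free (suc k) s
  Free k (em0 t s)      = Free k t ⊎ Free k s
  Free k (em1 t s)      = Free (suc k) t ⊎ Free (suc k) s
  Free k (Hyp i A)      = i ≡ k
  Free k (Wit i P)      = i ≡ k
  Free k (H0 P)         = ⊥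

  -- t has an active subterm H_a^{αP} m (a = index k): a subterm whose only
  -- free variable is a, i.e. m is closed and α is the only free variable of P
  Active : ℕ → Tm → PT → Set
  Active k m (pv i)         = ⊥
  Active k m (t · s)        = Active k m t ⊎ Active k m s
  Active k m (t ·ₘ n)       =
    (Σ Fm λ P → t ≡ Hyp k P × n ≡ m × ClosedT n × (∀ j → occF j P → j ≡ zero))
    ⊎ Active k m t
  Active k m (ƛ t)          = Active (suc k) m t
  Active k m (Λ t)          = Active k (renT suc m) t
  Active k m ⟨ t , s ⟩      = Active k m t ⊎ Active k m s
  Active k m (π₀ t)         = Active k m t
  Active k m (π₁ t)         = Active k m t
  Active k m (ι₀ t)         = Active k m t
  Active k m (ι₁ t)         = Active k m t
  Active k m (case t s r)   = Active k m t ⊎ (Active (suc k) m s ⊎ Active (suc k) m r)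
  Active k m (pair n t)     = Active k m t
  Active k m (unpack t s)   = Active k m t ⊎ Active (suc k) (renT suc m) s
  Active k m (em0 t s)      = Active k m t ⊎ Active k m s
  Active k m (em1 t s)      = Active (suc k) m t ⊎ Active (suc k) m s
  Active k m (Hyp i A)      = ⊥
  Active k m (Wit i P)      = ⊥
  Active k m (H0 P)         = ⊥

  -- Reduction

  infix 2 _⟶_ _↦_ _↦*_

  data _⟶_ : PT → PT → Set where
    β-ƛ      : ∀ {u t} → ƛ u · t ⟶ substPV zero t u
    β-Λ      : ∀ {u m} → Λ u ·ₘ m ⟶ subFO (m • var) u
    β-π₀     : ∀ {u₀ u₁} → π₀ ⟨ u₀ , u₁ ⟩ ⟶ u₀
    β-π₁     : ∀ {u₀ u₁} → π₁ ⟨ u₀ , u₁ ⟩ ⟶ u₁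
    β-ι₀     : ∀ {u t₀ t₁} → case (ι₀ u) t₀ t₁ ⟶ substPV zero u t₀
    β-ι₁     : ∀ {u t₀ t₁} → case (ι₁ u) t₀ t₁ ⟶ substPV zero u t₁
    β-∃      : ∀ {m u v} → unpack (pair m u) v ⟶ substPV zero u (subFO (m • var) v)
    p-app    : ∀ {u v w} → em0 u v · w ⟶ em0 (u · w) (v · w)
    p-appₘ   : ∀ {u v m} → em0 u v ·ₘ m ⟶ em0 (u ·ₘ m) (v ·ₘ m)
    p-π₀     : ∀ {u v} → π₀ (em0 u v) ⟶ em0 (π₀ u) (π₀ v)
    p-π₁     : ∀ {u v} → π₁ (em0 u v) ⟶ em0 (π₁ u) (π₁ v)
    p-case   : ∀ {u v w₁ w₂} → case (em0 u v) w₁ w₂ ⟶ em0 (case u w₁ w₂) (case v w₁ w₂)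
    p-unpack : ∀ {u v w} → unpack (em0 u v) w ⟶ em0 (unpack u w) (unpack v w)
    em1-drop : ∀ {u v} → ¬ Free zero u → em1 u v ⟶ renPV pred u
    em1-exc  : ∀ {u v m u'} → Active zero m u → ExH zero m u u' →
               em1 u v ⟶ em0 (exW zero m v) (em1 u' v)

  data _↦_ : PT → PT → Set where
    top    : ∀ {t t'} → t ⟶ t' → t ↦ t'
    app₁   : ∀ {t t' s} → t ↦ t' → t · s ↦ t' · s
    app₂   : ∀ {t s s'} → s ↦ s' → t · s ↦ t · s'
    appₘ   : ∀ {t t' m} → t ↦ t' → t ·ₘ m ↦ t' ·ₘ m
    ƛ-c    : ∀ {t t'} → t ↦ t' → ƛ t ↦ ƛ t'
    Λ-c    : ∀ {t t'} → t ↦ t' → Λ t ↦ Λ t'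
    ⟨⟩₁    : ∀ {t t' s} → t ↦ t' → ⟨ t , s ⟩ ↦ ⟨ t' , s ⟩
    ⟨⟩₂    : ∀ {t s s'} → s ↦ s' → ⟨ t , s ⟩ ↦ ⟨ t , s' ⟩
    π₀-c   : ∀ {t t'} → t ↦ t' → π₀ t ↦ π₀ t'
    π₁-c   : ∀ {t t'} → t ↦ t' → π₁ t ↦ π₁ t'
    ι₀-c   : ∀ {t t'} → t ↦ t' → ι₀ t ↦ ι₀ t'
    ι₁-c   : ∀ {t t'} → t ↦ t' → ι₁ t ↦ ι₁ t'
    case₁  : ∀ {t t' s r} → t ↦ t' → case t s r ↦ case t' s r
    case₂  : ∀ {t s s' r} → s ↦ s' → case t s r ↦ case t s' r
    case₃  : ∀ {t s r r'} → r ↦ r' → case t s r ↦ case t s r'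
    pair-c : ∀ {m t t'} → t ↦ t' → pair m t ↦ pair m t'
    unp₁   : ∀ {t t' s} → t ↦ t' → unpack t s ↦ unpack t' s
    unp₂   : ∀ {t s s'} → s ↦ s' → unpack t s ↦ unpack t s'
    em0₁   : ∀ {t t' s} → t ↦ t' → em0 t s ↦ em0 t' s
    em0₂   : ∀ {t s s'} → s ↦ s' → em0 t s ↦ em0 t s'
    em1₁   : ∀ {t t' s} → t ↦ t' → em1 t s ↦ em1 t' s
    em1₂   : ∀ {t s s'} → s ↦ s' → em1 t s ↦ em1 t s'

  _↦*_ : PT → PT → Set
  _↦*_ = Star _↦_

  Normal : PT → Set
  Normal t = ∀ t' → ¬ (t ↦ t')

  -- Quasi-closed terms, Herbrand normal forms

  -- QC p d t: t's only free variables (w.r.t. p bound proof/hypothesis and d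
  -- bound first-order variables) are hypothesis variables a, each occurring as
  -- H_a^{αA} with ∀α A simply universal.
  QC : ℕ → ℕ → PT → Set
  QC p d (pv i)         = i < p
  QC p d (t · s)        = QC p d t × QC p d s
  QC p d (t ·ₘ m)       = QC p d t × BoundT d m
  QC p d (ƛ t)          = QC (suc p) d t
  QC p d (Λ t)          = QC p (suc d) t
  QC p d ⟨ t , s ⟩      = QC p d t × QC p d s
  QC p d (π₀ t)         = QC p d t
  QC p d (π₁ t)         = QC p d t
  QC p d (ι₀ t)         = QC p d t
  QC p d (ι₁ t)         = QC p d t
  QC p d (case t s r)   = QC p d t × (QC (suc p) d s × QC (suc p) d r)
  QC p d (pair m t)     = BoundT d m × QC p d t
  QC p d (unpack t s)   = QC p d t × QC (suc p) (suc d) s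
  QC p d (em0 t s)      = QC p d t × QC p d s
  QC p d (em1 t s)      = QC (suc p) d t × QC (suc p) d s
  QC p d (Hyp i A)      = BoundF (suc d) A × (i < p ⊎ SimplyUniversal (∀f A))
  QC p d (Wit i P)      = BoundF (suc d) P × i < p
  QC p d (H0 P)         = BoundF d P

  QuasiClosed : PT → Set
  QuasiClosed t = QC zero zero t

  data HerbrandNF : PT → Set where
    hnf-pair : ∀ {m u} → Normal (pair m u) → HerbrandNF (pair m u)
    hnf-em0  : ∀ {u v} → HerbrandNF u → HerbrandNF v → HerbrandNF (em0 u v)

  witnesses : PT → List Tm
  witnesses (pair m u) = [ m ]
  witnesses (em0 u v)  = witnesses u ++ witnesses v
  witnesses _          = []

  ⋁ : List Fm → Fm
  ⋁ []           = ⊥f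
  ⋁ (A ∷ [])     = A
  ⋁ (A ∷ B ∷ As) = A ∨f ⋁ (B ∷ As)

-- Reduction preserves typing and a mild weakening of quasi-closedness, so it
-- suffices to classify normal terms. In a normal quasi-closed term every
-- neutral subterm (a variable or axiom under a spine of eliminations) has a
-- simply universal type, so it can have neither ∃- nor ∨-type; hence a normal
-- term of type ∃αA is built from pairs (m, u) by EM₀-splits alone. An EM₁⁻
-- node u ∥ₐ v is never normal: as u has ∃-type over a negative body, every free
-- occurrence of a : ∀αP in u is active, which yields either an exception
-- redex or, if a does not occur, the drop redex. Finally each EM₀-split of the
-- Herbrand normal form becomes an EM₀-split of a proof of A[m₀/α] ∨ … ∨ A[mₖ/α].
module Submission where

open import Defs
open import Data.Empty using (⊥; ⊥-elim)
open import Data.List using (List; []; _∷_; _++_; map; [_])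
open import Data.List.Membership.Propositional using (_∈_)
open import Data.List.Membership.Propositional.Properties
  using (∈-map⁺; ∈-map⁻; ∈-++⁺ˡ; ∈-++⁺ʳ; ∈-++⁻)
open import Data.List.Properties using (map-++; map-cong)
open import Data.List.Relation.Unary.Any using (here; there)
open import Data.Nat using (ℕ; zero; suc; pred; _<_; s≤s; z≤n)
open import Data.Product using (Σ; _×_; _,_; proj₁; proj₂; map₁; map₂)
open import Data.Sum as Sum using (_⊎_; inj₁; inj₂)
open import Data.Unit using (⊤; tt)
open import Data.Vec using (Vec; []; _∷_)
open import Function using (_∘_; _$_; id; case_of_)
open import Relation.Binary.Construct.Closure.ReflexiveTransitive using (ε; _◅_)
open import Relation.Binary.PropositionalEquality
  using (_≡_; _≢_; refl; sym; trans; cong; cong₂; subst; _≗_; module ≡-Reasoning)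
open import Relation.Nullary using (¬_; yes; no; ¬¬-excluded-middle)

module _ (L : Signature) where
  open Syntax L
  open ≡-Reasoning

  -- First-order substitution

  subT-cong : ∀ {σ τ} → σ ≗ τ → subT σ ≗ subT τ
  subV-cong : ∀ {σ τ n} → σ ≗ τ → subV {n} σ ≗ subV τ
  subT-cong σ≗τ (var n)    = σ≗τ n
  subT-cong σ≗τ (fun f ts) = cong (fun f) (subV-cong σ≗τ ts)
  subV-cong σ≗τ []         = refl
  subV-cong σ≗τ (t ∷ ts)   = cong₂ _∷_ (subT-cong σ≗τ t) (subV-cong σ≗τ ts)

  renT≗subT : ∀ ρ → renT ρ ≗ subT (var ∘ ρ)
  renV≗subV : ∀ {n} ρ → renV {n} ρ ≗ subV (var ∘ ρ)
  renT≗subT ρ (var n)    = refl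
  renT≗subT ρ (fun f ts) = cong (fun f) (renV≗subV ρ ts)
  renV≗subV ρ []         = refl
  renV≗subV ρ (t ∷ ts)   = cong₂ _∷_ (renT≗subT ρ t) (renV≗subV ρ ts)

  subT-∘ : ∀ σ τ → subT σ ∘ subT τ ≗ subT (subT σ ∘ τ)
  subV-∘ : ∀ {n} σ τ → subV {n} σ ∘ subV τ ≗ subV (subT σ ∘ τ)
  subT-∘ σ τ (var n)    = refl
  subT-∘ σ τ (fun f ts) = cong (fun f) (subV-∘ σ τ ts)
  subV-∘ σ τ []         = refl
  subV-∘ σ τ (t ∷ ts)   = cong₂ _∷_ (subT-∘ σ τ t) (subV-∘ σ τ ts)

  subT-id : subT var ≗ id
  subV-id : ∀ {n} → subV {n} var ≗ id
  subT-id (var n)    = refl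
  subT-id (fun f ts) = cong (fun f) (subV-id ts)
  subV-id []         = refl
  subV-id (t ∷ ts)   = cong₂ _∷_ (subT-id t) (subV-id ts)

  subT-exts-wk : ∀ σ → subT (exts σ) ∘ renT suc ≗ renT suc ∘ subT σ
  subT-exts-wk σ m = begin
    subT (exts σ) (renT suc m)              ≡⟨ cong (subT (exts σ)) (renT≗subT suc m) ⟩
    subT (exts σ) (subT (var ∘ suc) m)      ≡⟨ subT-∘ (exts σ) (var ∘ suc) m ⟩
    subT (renT suc ∘ σ) m                   ≡⟨ subT-cong (renT≗subT suc ∘ σ) m ⟩
    subT (subT (var ∘ suc) ∘ σ) m           ≡⟨ subT-∘ (var ∘ suc) σ m ⟨
    subT (var ∘ suc) (subT σ m)             ≡⟨ renT≗subT suc (subT σ m) ⟨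
    renT suc (subT σ m)                     ∎

  subT-inst-wk : ∀ m → subT (m • var) ∘ renT suc ≗ id
  subT-inst-wk m n = begin
    subT (m • var) (renT suc n)             ≡⟨ cong (subT (m • var)) (renT≗subT suc n) ⟩
    subT (m • var) (subT (var ∘ suc) n)     ≡⟨ subT-∘ (m • var) (var ∘ suc) n ⟩
    subT var n                              ≡⟨ subT-id n ⟩
    n                                       ∎

  exts-cong : ∀ {σ τ} → σ ≗ τ → exts σ ≗ exts τ
  exts-cong σ≗τ zero    = refl
  exts-cong σ≗τ (suc n) = cong (renT suc) (σ≗τ n)

  exts-var : exts var ≗ var
  exts-var zero    = refl
  exts-var (suc n) = refl

  exts-ren : ∀ ρ → exts (var ∘ ρ) ≗ var ∘ ext ρ
  exts-ren ρ zero    = refl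
  exts-ren ρ (suc n) = refl

  exts-∘ : ∀ σ τ → subT (exts σ) ∘ exts τ ≗ exts (subT σ ∘ τ)
  exts-∘ σ τ zero    = refl
  exts-∘ σ τ (suc n) = subT-exts-wk σ (τ n)

  subF-cong : ∀ {σ τ} → σ ≗ τ → subF σ ≗ subF τ
  subF-cong σ≗τ (atom p ts) = cong (atom p) (subV-cong σ≗τ ts)
  subF-cong σ≗τ ⊥f          = refl
  subF-cong σ≗τ (A ∧f B)    = cong₂ _∧f_ (subF-cong σ≗τ A) (subF-cong σ≗τ B)
  subF-cong σ≗τ (A ∨f B)    = cong₂ _∨f_ (subF-cong σ≗τ A) (subF-cong σ≗τ B)
  subF-cong σ≗τ (A ⇒f B)    = cong₂ _⇒f_ (subF-cong σ≗τ A) (subF-cong σ≗τ B)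
  subF-cong σ≗τ (∀f A)      = cong ∀f (subF-cong (exts-cong σ≗τ) A)
  subF-cong σ≗τ (∃f A)      = cong ∃f (subF-cong (exts-cong σ≗τ) A)

  renF≗subF : ∀ ρ → renF ρ ≗ subF (var ∘ ρ)
  renF-ext≗subF-exts : ∀ ρ → renF (ext ρ) ≗ subF (exts (var ∘ ρ))
  renF≗subF ρ (atom p ts) = cong (atom p) (renV≗subV ρ ts)
  renF≗subF ρ ⊥f          = refl
  renF≗subF ρ (A ∧f B)    = cong₂ _∧f_ (renF≗subF ρ A) (renF≗subF ρ B)
  renF≗subF ρ (A ∨f B)    = cong₂ _∨f_ (renF≗subF ρ A) (renF≗subF ρ B)
  renF≗subF ρ (A ⇒f B)    = cong₂ _⇒f_ (renF≗subF ρ A) (renF≗subF ρ B)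
  renF≗subF ρ (∀f A)      = cong ∀f (renF-ext≗subF-exts ρ A)
  renF≗subF ρ (∃f A)      = cong ∃f (renF-ext≗subF-exts ρ A)
  renF-ext≗subF-exts ρ A  = trans (renF≗subF (ext ρ) A) (sym (subF-cong (exts-ren ρ) A))

  subF-∘ : ∀ σ τ → subF σ ∘ subF τ ≗ subF (subT σ ∘ τ)
  subF-∘ σ τ (atom p ts) = cong (atom p) (subV-∘ σ τ ts)
  subF-∘ σ τ ⊥f          = refl
  subF-∘ σ τ (A ∧f B)    = cong₂ _∧f_ (subF-∘ σ τ A) (subF-∘ σ τ B)
  subF-∘ σ τ (A ∨f B)    = cong₂ _∨f_ (subF-∘ σ τ A) (subF-∘ σ τ B)
  subF-∘ σ τ (A ⇒f B)    = cong₂ _⇒f_ (subF-∘ σ τ A) (subF-∘ σ τ B)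
  subF-∘ σ τ (∀f A)      = cong ∀f (trans (subF-∘ (exts σ) (exts τ) A) (subF-cong (exts-∘ σ τ) A))
  subF-∘ σ τ (∃f A)      = cong ∃f (trans (subF-∘ (exts σ) (exts τ) A) (subF-cong (exts-∘ σ τ) A))

  subF-id : subF var ≗ id
  subF-id (atom p ts) = cong (atom p) (subV-id ts)
  subF-id ⊥f          = refl
  subF-id (A ∧f B)    = cong₂ _∧f_ (subF-id A) (subF-id B)
  subF-id (A ∨f B)    = cong₂ _∨f_ (subF-id A) (subF-id B)
  subF-id (A ⇒f B)    = cong₂ _⇒f_ (subF-id A) (subF-id B)
  subF-id (∀f A)      = cong ∀f (trans (subF-cong exts-var A) (subF-id A))
  subF-id (∃f A)      = cong ∃f (trans (subF-cong exts-var A) (subF-id A))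

  subF-inst : ∀ σ A m → subF σ (A [ m ]F) ≡ subF (exts σ) A [ subT σ m ]F
  subF-inst σ A m = begin
    subF σ (subF (m • var) A)                   ≡⟨ subF-∘ σ (m • var) A ⟩
    subF (subT σ ∘ (m • var)) A                 ≡⟨ subF-cong pointwise A ⟩
    subF (subT (subT σ m • var) ∘ exts σ) A     ≡⟨ subF-∘ (subT σ m • var) (exts σ) A ⟨
    subF (subT σ m • var) (subF (exts σ) A)     ∎
    where
    pointwise : subT σ ∘ (m • var) ≗ subT (subT σ m • var) ∘ exts σ
    pointwise zero    = refl
    pointwise (suc n) = sym (subT-inst-wk (subT σ m) (σ n))

  subF-exts-wk : ∀ σ B → subF (exts σ) (renF suc B) ≡ renF suc (subF σ B)
  subF-exts-wk σ B = begin
    subF (exts σ) (renF suc B)                  ≡⟨ cong (subF (exts σ)) (renF≗subF suc B) ⟩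
    subF (exts σ) (subF (var ∘ suc) B)          ≡⟨ subF-∘ (exts σ) (var ∘ suc) B ⟩
    subF (renT suc ∘ σ) B                       ≡⟨ subF-cong (renT≗subT suc ∘ σ) B ⟩
    subF (subT (var ∘ suc) ∘ σ) B               ≡⟨ subF-∘ (var ∘ suc) σ B ⟨
    subF (var ∘ suc) (subF σ B)                 ≡⟨ renF≗subF suc (subF σ B) ⟨
    renF suc (subF σ B)                         ∎

  inst-wk : ∀ m B → renF suc B [ m ]F ≡ B
  inst-wk m B = begin
    subF (m • var) (renF suc B)                 ≡⟨ cong (subF (m • var)) (renF≗subF suc B) ⟩
    subF (m • var) (subF (var ∘ suc) B)         ≡⟨ subF-∘ (m • var) (var ∘ suc) B ⟩
    subF var B                                  ≡⟨ subF-id B ⟩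
    B                                           ∎

  renF-inst : ∀ ρ A m → renF ρ (A [ m ]F) ≡ renF (ext ρ) A [ renT ρ m ]F
  renF-inst ρ A m = begin
    renF ρ (A [ m ]F)                           ≡⟨ renF≗subF ρ (A [ m ]F) ⟩
    subF (var ∘ ρ) (A [ m ]F)                   ≡⟨ subF-inst (var ∘ ρ) A m ⟩
    subF (exts (var ∘ ρ)) A [ subT (var ∘ ρ) m ]F
      ≡⟨ cong₂ _[_]F (renF-ext≗subF-exts ρ A) (renT≗subT ρ m) ⟨
    renF (ext ρ) A [ renT ρ m ]F                ∎

  subFO-cong : ∀ {σ τ} → σ ≗ τ → subFO σ ≗ subFO τ
  subFO-cong h (pv i)       = refl
  subFO-cong h (t · s)      = cong₂ _·_ (subFO-cong h t) (subFO-cong h s)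
  subFO-cong h (t ·ₘ m)     = cong₂ _·ₘ_ (subFO-cong h t) (subT-cong h m)
  subFO-cong h (ƛ t)        = cong ƛ (subFO-cong h t)
  subFO-cong h (Λ t)        = cong Λ (subFO-cong (exts-cong h) t)
  subFO-cong h ⟨ t , s ⟩    = cong₂ ⟨_,_⟩ (subFO-cong h t) (subFO-cong h s)
  subFO-cong h (π₀ t)       = cong π₀ (subFO-cong h t)
  subFO-cong h (π₁ t)       = cong π₁ (subFO-cong h t)
  subFO-cong h (ι₀ t)       = cong ι₀ (subFO-cong h t)
  subFO-cong h (ι₁ t)       = cong ι₁ (subFO-cong h t)
  subFO-cong h (case t s r) =
    cong₂ (_$_) (cong₂ case (subFO-cong h t) (subFO-cong h s)) (subFO-cong h r)
  subFO-cong h (pair m t)   = cong₂ pair (subT-cong h m) (subFO-cong h t)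
  subFO-cong h (unpack t s) = cong₂ unpack (subFO-cong h t) (subFO-cong (exts-cong h) s)
  subFO-cong h (em0 t s)    = cong₂ em0 (subFO-cong h t) (subFO-cong h s)
  subFO-cong h (em1 t s)    = cong₂ em1 (subFO-cong h t) (subFO-cong h s)
  subFO-cong h (Hyp i A)    = cong (Hyp i) (subF-cong (exts-cong h) A)
  subFO-cong h (Wit i A)    = cong (Wit i) (subF-cong (exts-cong h) A)
  subFO-cong h (H0 A)       = cong H0 (subF-cong h A)

  renFO≗subFO : ∀ ρ → renFO ρ ≗ subFO (var ∘ ρ)
  renFO≗subFO ρ (pv i)       = refl
  renFO≗subFO ρ (t · s)      = cong₂ _·_ (renFO≗subFO ρ t) (renFO≗subFO ρ s)
  renFO≗subFO ρ (t ·ₘ m)     = cong₂ _·ₘ_ (renFO≗subFO ρ t) (renT≗subT ρ m)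
  renFO≗subFO ρ (ƛ t)        = cong ƛ (renFO≗subFO ρ t)
  renFO≗subFO ρ (Λ t)        =
    cong Λ (trans (renFO≗subFO (ext ρ) t) (sym (subFO-cong (exts-ren ρ) t)))
  renFO≗subFO ρ ⟨ t , s ⟩    = cong₂ ⟨_,_⟩ (renFO≗subFO ρ t) (renFO≗subFO ρ s)
  renFO≗subFO ρ (π₀ t)       = cong π₀ (renFO≗subFO ρ t)
  renFO≗subFO ρ (π₁ t)       = cong π₁ (renFO≗subFO ρ t)
  renFO≗subFO ρ (ι₀ t)       = cong ι₀ (renFO≗subFO ρ t)
  renFO≗subFO ρ (ι₁ t)       = cong ι₁ (renFO≗subFO ρ t)
  renFO≗subFO ρ (case t s r) =
    cong₂ (_$_) (cong₂ case (renFO≗subFO ρ t) (renFO≗subFO ρ s)) (renFO≗subFO ρ r)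
  renFO≗subFO ρ (pair m t)   = cong₂ pair (renT≗subT ρ m) (renFO≗subFO ρ t)
  renFO≗subFO ρ (unpack t s) =
    cong₂ unpack (renFO≗subFO ρ t) (trans (renFO≗subFO (ext ρ) s) (sym (subFO-cong (exts-ren ρ) s)))
  renFO≗subFO ρ (em0 t s)    = cong₂ em0 (renFO≗subFO ρ t) (renFO≗subFO ρ s)
  renFO≗subFO ρ (em1 t s)    = cong₂ em1 (renFO≗subFO ρ t) (renFO≗subFO ρ s)
  renFO≗subFO ρ (Hyp i A)    = cong (Hyp i) (renF-ext≗subF-exts ρ A)
  renFO≗subFO ρ (Wit i A)    = cong (Wit i) (renF-ext≗subF-exts ρ A)
  renFO≗subFO ρ (H0 A)       = cong H0 (renF≗subF ρ A)

  NegProp-subF : ∀ σ {A} → NegProp A → NegProp (subF σ A)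
  NegProp-subF σ np-atom    = np-atom
  NegProp-subF σ np-⊥       = np-⊥
  NegProp-subF σ (np-∧ a b) = np-∧ (NegProp-subF σ a) (NegProp-subF σ b)
  NegProp-subF σ (np-⇒ a b) = np-⇒ (NegProp-subF σ a) (NegProp-subF σ b)

  SimplyUniversal-subF : ∀ σ {A} → SimplyUniversal A → SimplyUniversal (subF σ A)
  SimplyUniversal-subF σ (su-base p) = su-base (NegProp-subF σ p)
  SimplyUniversal-subF σ (su-∀ s)    = su-∀ (SimplyUniversal-subF (exts σ) s)

  NegProp-renF : ∀ ρ {A} → NegProp A → NegProp (renF ρ A)
  NegProp-renF ρ np-atom    = np-atom
  NegProp-renF ρ np-⊥       = np-⊥
  NegProp-renF ρ (np-∧ a b) = np-∧ (NegProp-renF ρ a) (NegProp-renF ρ b)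
  NegProp-renF ρ (np-⇒ a b) = np-⇒ (NegProp-renF ρ a) (NegProp-renF ρ b)

  NegProp-renF⁻ : ∀ ρ A → NegProp (renF ρ A) → NegProp A
  NegProp-renF⁻ ρ (atom p ts) _          = np-atom
  NegProp-renF⁻ ρ ⊥f          _          = np-⊥
  NegProp-renF⁻ ρ (A ∧f B)    (np-∧ a b) = np-∧ (NegProp-renF⁻ ρ A a) (NegProp-renF⁻ ρ B b)
  NegProp-renF⁻ ρ (A ⇒f B)    (np-⇒ a b) = np-⇒ (NegProp-renF⁻ ρ A a) (NegProp-renF⁻ ρ B b)

  ¬NegProp-∀ : ∀ {A} → ¬ NegProp (∀f A)
  ¬NegProp-∀ ()

  ¬NegProp-∃ : ∀ {A} → ¬ NegProp (∃f A)
  ¬NegProp-∃ ()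

  -- Contexts

  ∋-functional : ∀ {Γ i e e'} → Γ ∋ i ⦂ e → Γ ∋ i ⦂ e' → e ≡ e'
  ∋-functional here      here      = refl
  ∋-functional (there x) (there y) = ∋-functional x y

  ∋-map⁺ : ∀ {Γ i e} (f : Entry → Entry) → Γ ∋ i ⦂ e → map f Γ ∋ i ⦂ f e
  ∋-map⁺ f here      = here
  ∋-map⁺ f (there x) = there (∋-map⁺ f x)

  ∋-map⁻ : ∀ {Γ i e'} (f : Entry → Entry) → map f Γ ∋ i ⦂ e' →
           Σ Entry λ e → Γ ∋ i ⦂ e × e' ≡ f e
  ∋-map⁻ {_ ∷ Γ} f here      = _ , here , refl
  ∋-map⁻ {_ ∷ Γ} f (there x) with ∋-map⁻ f x
  ... | e , y , eq = e , there y , eq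

  ∋-++⁺ˡ : ∀ {Γ Δ i e} → Γ ∋ i ⦂ e → (Γ ++ Δ) ∋ i ⦂ e
  ∋-++⁺ˡ here      = here
  ∋-++⁺ˡ (there x) = there (∋-++⁺ˡ x)

  ∋-∷ʳ⁻ : ∀ {Γ e' i e} → (Γ ++ [ e' ]) ∋ i ⦂ e → Γ ∋ i ⦂ e ⊎ e ≡ e'
  ∋-∷ʳ⁻ {[]}    here      = inj₂ refl
  ∋-∷ʳ⁻ {_ ∷ Γ} here      = inj₁ here
  ∋-∷ʳ⁻ {_ ∷ Γ} (there x) = Sum.map₁ there (∋-∷ʳ⁻ {Γ} x)

  subE : (ℕ → Tm) → Entry → Entry
  subE σ (prf A) = prf (subF σ A)
  subE σ (hyp A) = hyp (subF σ A)

  subE-⇑ : ∀ σ Γ → map (subE (exts σ)) (⇑ Γ) ≡ ⇑ (map (subE σ) Γ)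
  subE-⇑ σ []          = refl
  subE-⇑ σ (prf A ∷ Γ) = cong₂ _∷_ (cong prf (subF-exts-wk σ A)) (subE-⇑ σ Γ)
  subE-⇑ σ (hyp A ∷ Γ) = cong₂ _∷_ (cong hyp (subF-exts-wk σ A)) (subE-⇑ σ Γ)

  inst-⇑ : ∀ m Γ → map (subE (m • var)) (⇑ Γ) ≡ Γ
  inst-⇑ m []          = refl
  inst-⇑ m (prf A ∷ Γ) = cong₂ _∷_ (cong prf (inst-wk m A)) (inst-⇑ m Γ)
  inst-⇑ m (hyp A ∷ Γ) = cong₂ _∷_ (cong hyp (inst-wk m A)) (inst-⇑ m Γ)

  renE≗subE : ∀ ρ → renE ρ ≗ subE (var ∘ ρ)
  renE≗subE ρ (prf A) = cong prf (renF≗subF ρ A)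
  renE≗subE ρ (hyp A) = cong hyp (renF≗subF ρ A)

  ⊢-cast : ∀ {Γ Γ' t A A'} → Γ ≡ Γ' → A ≡ A' → Γ ⊢ t ⦂ A → Γ' ⊢ t ⦂ A'
  ⊢-cast refl refl d = d

  ⊢-subFO : ∀ {Γ t A} σ → Γ ⊢ t ⦂ A → map (subE σ) Γ ⊢ subFO σ t ⦂ subF σ A
  ⊢-subFO σ (ax x)               = ax (∋-map⁺ (subE σ) x)
  ⊢-subFO σ (∧I d e)             = ∧I (⊢-subFO σ d) (⊢-subFO σ e)
  ⊢-subFO σ (∧E₀ d)              = ∧E₀ (⊢-subFO σ d)
  ⊢-subFO σ (∧E₁ d)              = ∧E₁ (⊢-subFO σ d)
  ⊢-subFO σ (⇒E d e)             = ⇒E (⊢-subFO σ d) (⊢-subFO σ e)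
  ⊢-subFO σ (⇒I d)               = ⇒I (⊢-subFO σ d)
  ⊢-subFO σ (∨I₀ d)              = ∨I₀ (⊢-subFO σ d)
  ⊢-subFO σ (∨I₁ d)              = ∨I₁ (⊢-subFO σ d)
  ⊢-subFO σ (∨E d e f)           = ∨E (⊢-subFO σ d) (⊢-subFO σ e) (⊢-subFO σ f)
  ⊢-subFO σ (∀E {A = A} m d)     =
    ⊢-cast refl (sym (subF-inst σ A m)) (∀E (subT σ m) (⊢-subFO σ d))
  ⊢-subFO {Γ} σ (∀I d)           = ∀I (⊢-cast (subE-⇑ σ Γ) refl (⊢-subFO (exts σ) d))
  ⊢-subFO σ (∃I {A = A} m d)     = ∃I (subT σ m) (⊢-cast refl (subF-inst σ A m) (⊢-subFO σ d))
  ⊢-subFO {Γ} σ (∃E {C = C} d e) =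
    ∃E (⊢-subFO σ d) (⊢-cast (cong (_ ∷_) (subE-⇑ σ Γ)) (subF-exts-wk σ C) (⊢-subFO (exts σ) e))
  ⊢-subFO σ (H-ax s x)           = H-ax (SimplyUniversal-subF (exts σ) s) (∋-map⁺ (subE σ) x)
  ⊢-subFO σ (W-ax s x)           = W-ax (NegProp-subF (exts σ) s) (∋-map⁺ (subE σ) x)
  ⊢-subFO σ (H0-ax s x)          = H0-ax (NegProp-subF σ s) (∈-map⁺ (subE σ) x)
  ⊢-subFO σ (H0-efq s)           = H0-efq (NegProp-subF σ s)
  ⊢-subFO {Γ} σ (EM0 s d e)      = EM0 (NegProp-subF σ s)
    (⊢-cast (map-++ (subE σ) Γ _) refl (⊢-subFO σ d))
    (⊢-cast (map-++ (subE σ) Γ _) refl (⊢-subFO σ e))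
  ⊢-subFO σ (EM1 s s' d e)       =
    EM1 (NegProp-subF (exts σ) s) (NegProp-subF (exts σ) s') (⊢-subFO σ d) (⊢-subFO σ e)

  ⊢-wkFO : ∀ {Γ u B} → Γ ⊢ u ⦂ B → ⇑ Γ ⊢ renFO suc u ⦂ renF suc B
  ⊢-wkFO {Γ} {u} {B} d =
    subst (_ ⊢_⦂ _) (sym (renFO≗subFO suc u))
      (⊢-cast (sym (map-cong (renE≗subE suc) Γ)) (sym (renF≗subF suc B)) (⊢-subFO (var ∘ suc) d))

  -- Renaming and substituting proof variables

  -- H₀ refers to its negative hypothesis by membership rather than by index,
  -- so a renaming need only transport the other entries, together with an
  -- inclusion of the negative hypotheses.
  NegHyp : Entry → Set
  NegHyp (prf _) = ⊥
  NegHyp (hyp P) = NegProp P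

  record Renaming (F : ℕ → Set) (ρ : ℕ → ℕ) (Γ Δ : Ctx) : Set where
    constructor mkRenaming
    field rename-∋ : ∀ {i e} → F i → Γ ∋ i ⦂ e → ¬ NegHyp e → Δ ∋ ρ i ⦂ e
  open Renaming public

  NegHyps⊆ : Ctx → Ctx → Set
  NegHyps⊆ Γ Δ = ∀ {P} → NegProp P → hyp P ∈ Γ → hyp P ∈ Δ

  Renaming-∷ : ∀ {F G ρ ρ' Γ Δ} e → Renaming F ρ Γ Δ →
               (∀ j → G (suc j) → F j × ρ' (suc j) ≡ suc (ρ j)) → ρ' 0 ≡ 0 →
               Renaming G ρ' (e ∷ Γ) (e ∷ Δ)
  Renaming-∷ {G = G} {ρ' = ρ'} {Γ} {Δ} e r step base = mkRenaming go
    where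
    go : ∀ {i e'} → G i → (e ∷ Γ) ∋ i ⦂ e' → ¬ NegHyp e' → (e ∷ Δ) ∋ ρ' i ⦂ e'
    go g here      _  = subst (λ j → (e ∷ Δ) ∋ j ⦂ e) (sym base) here
    go g (there x) nh with step _ g
    ... | f , eq = subst (λ j → (e ∷ Δ) ∋ j ⦂ _) (sym eq) (there (rename-∋ r f x nh))

  NegHyp-renE : ∀ ρ e → NegHyp e → NegHyp (renE ρ e)
  NegHyp-renE ρ (hyp P) p = NegProp-renF ρ p

  Renaming-⇑ : ∀ {F ρ Γ Δ} → Renaming F ρ Γ Δ → Renaming F ρ (⇑ Γ) (⇑ Δ)
  Renaming-⇑ {F} {ρ} {Γ} {Δ} r = mkRenaming go
    where
    go : ∀ {i e'} → F i → ⇑ Γ ∋ i ⦂ e' → ¬ NegHyp e' → ⇑ Δ ∋ ρ i ⦂ e'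
    go f x nh with ∋-map⁻ (renE suc) x
    ... | e , y , refl = ∋-map⁺ (renE suc) (rename-∋ r f y (nh ∘ NegHyp-renE suc e))

  Renaming-∷ʳ : ∀ {F ρ Γ Δ P} → NegProp P → Renaming F ρ Γ Δ →
                Renaming F ρ (Γ ++ [ hyp P ]) (Δ ++ [ hyp P ])
  Renaming-∷ʳ {F} {ρ} {Γ} {Δ} {P} p r = mkRenaming go
    where
    go : ∀ {i e} → F i → (Γ ++ [ hyp P ]) ∋ i ⦂ e → ¬ NegHyp e → (Δ ++ [ hyp P ]) ∋ ρ i ⦂ e
    go f x nh with ∋-∷ʳ⁻ x
    ... | inj₁ y    = ∋-++⁺ˡ (rename-∋ r f y nh)
    ... | inj₂ refl = ⊥-elim (nh p)

  Renaming-mono : ∀ {F G ρ Γ Δ} → (∀ {i} → G i → F i) → Renaming F ρ Γ Δ → Renaming G ρ Γ Δ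
  Renaming-mono G⇒F r = mkRenaming (rename-∋ r ∘ G⇒F)

  NegHyps⊆-∷ : ∀ {Γ Δ} e → NegHyps⊆ Γ Δ → NegHyps⊆ (e ∷ Γ) (e ∷ Δ)
  NegHyps⊆-∷ e Γ⊆Δ p (here eq) = here eq
  NegHyps⊆-∷ e Γ⊆Δ p (there x) = there (Γ⊆Δ p x)

  NegHyps⊆-⇑ : ∀ {Γ Δ} → NegHyps⊆ Γ Δ → NegHyps⊆ (⇑ Γ) (⇑ Δ)
  NegHyps⊆-⇑ Γ⊆Δ p x with ∈-map⁻ (renE suc) x
  ... | hyp P , y , refl = ∈-map⁺ (renE suc) (Γ⊆Δ (NegProp-renF⁻ suc P p) y)

  NegHyps⊆-∷ʳ : ∀ {Γ Δ} P → NegHyps⊆ Γ Δ → NegHyps⊆ (Γ ++ [ hyp P ]) (Δ ++ [ hyp P ])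
  NegHyps⊆-∷ʳ {Γ} {Δ} P Γ⊆Δ p x with ∈-++⁻ Γ x
  ... | inj₁ y = ∈-++⁺ˡ (Γ⊆Δ p y)
  ... | inj₂ y = ∈-++⁺ʳ Δ y

  ⊢-renPV : ∀ {Γ Δ t A} ρ → Γ ⊢ t ⦂ A → Renaming (λ i → Free i t) ρ Γ Δ → NegHyps⊆ Γ Δ →
            Δ ⊢ renPV ρ t ⦂ A
  ⊢-renPV ρ (ax x)         r Γ⊆Δ = ax (rename-∋ r refl x λ ())
  ⊢-renPV ρ (∧I d e)       r Γ⊆Δ =
    ∧I (⊢-renPV ρ d (Renaming-mono inj₁ r) Γ⊆Δ) (⊢-renPV ρ e (Renaming-mono inj₂ r) Γ⊆Δ)
  ⊢-renPV ρ (∧E₀ d)        r Γ⊆Δ = ∧E₀ (⊢-renPV ρ d r Γ⊆Δ)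
  ⊢-renPV ρ (∧E₁ d)        r Γ⊆Δ = ∧E₁ (⊢-renPV ρ d r Γ⊆Δ)
  ⊢-renPV ρ (⇒E d e)       r Γ⊆Δ =
    ⇒E (⊢-renPV ρ d (Renaming-mono inj₁ r) Γ⊆Δ) (⊢-renPV ρ e (Renaming-mono inj₂ r) Γ⊆Δ)
  ⊢-renPV ρ (⇒I d)         r Γ⊆Δ =
    ⇒I (⊢-renPV (ext ρ) d (Renaming-∷ _ r (λ _ f → f , refl) refl) (NegHyps⊆-∷ _ Γ⊆Δ))
  ⊢-renPV ρ (∨I₀ d)        r Γ⊆Δ = ∨I₀ (⊢-renPV ρ d r Γ⊆Δ)
  ⊢-renPV ρ (∨I₁ d)        r Γ⊆Δ = ∨I₁ (⊢-renPV ρ d r Γ⊆Δ)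
  ⊢-renPV ρ (∨E d e f)     r Γ⊆Δ = ∨E (⊢-renPV ρ d (Renaming-mono inj₁ r) Γ⊆Δ)
    (⊢-renPV (ext ρ) e (Renaming-∷ _ r (λ _ f → inj₂ (inj₁ f) , refl) refl) (NegHyps⊆-∷ _ Γ⊆Δ))
    (⊢-renPV (ext ρ) f (Renaming-∷ _ r (λ _ f → inj₂ (inj₂ f) , refl) refl) (NegHyps⊆-∷ _ Γ⊆Δ))
  ⊢-renPV ρ (∀E m d)       r Γ⊆Δ = ∀E m (⊢-renPV ρ d r Γ⊆Δ)
  ⊢-renPV ρ (∀I d)         r Γ⊆Δ = ∀I (⊢-renPV ρ d (Renaming-⇑ r) (NegHyps⊆-⇑ Γ⊆Δ))
  ⊢-renPV ρ (∃I m d)       r Γ⊆Δ = ∃I m (⊢-renPV ρ d r Γ⊆Δ)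
  ⊢-renPV ρ (∃E d e)       r Γ⊆Δ = ∃E (⊢-renPV ρ d (Renaming-mono inj₁ r) Γ⊆Δ)
    (⊢-renPV (ext ρ) e (Renaming-∷ _ (Renaming-⇑ r) (λ _ f → inj₂ f , refl) refl)
                       (NegHyps⊆-∷ _ (NegHyps⊆-⇑ Γ⊆Δ)))
  ⊢-renPV ρ (H-ax s x)     r Γ⊆Δ = H-ax s (rename-∋ r refl x ¬NegProp-∀)
  ⊢-renPV ρ (W-ax s x)     r Γ⊆Δ = W-ax s (rename-∋ r refl x ¬NegProp-∃)
  ⊢-renPV ρ (H0-ax s x)    r Γ⊆Δ = H0-ax s (Γ⊆Δ s x)
  ⊢-renPV ρ (H0-efq s)     r Γ⊆Δ = H0-efq s
  ⊢-renPV ρ (EM0 s d e)    r Γ⊆Δ = EM0 s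
    (⊢-renPV ρ d (Renaming-∷ʳ (np-⇒ s np-⊥) (Renaming-mono inj₁ r)) (NegHyps⊆-∷ʳ _ Γ⊆Δ))
    (⊢-renPV ρ e (Renaming-∷ʳ s (Renaming-mono inj₂ r)) (NegHyps⊆-∷ʳ _ Γ⊆Δ))
  ⊢-renPV ρ (EM1 s s' d e) r Γ⊆Δ = EM1 s s'
    (⊢-renPV (ext ρ) d (Renaming-∷ _ r (λ _ f → inj₁ f , refl) refl) (NegHyps⊆-∷ _ Γ⊆Δ))
    (⊢-renPV (ext ρ) e (Renaming-∷ _ r (λ _ f → inj₂ f , refl) refl) (NegHyps⊆-∷ _ Γ⊆Δ))

  ext-id : ∀ {ρ} → ρ ≗ id → ext ρ ≗ id
  ext-id h zero    = refl
  ext-id h (suc i) = cong suc (h i)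

  renPV-id : ∀ {ρ} → ρ ≗ id → renPV ρ ≗ id
  renPV-id h (pv i)       = cong pv (h i)
  renPV-id h (t · s)      = cong₂ _·_ (renPV-id h t) (renPV-id h s)
  renPV-id h (t ·ₘ m)     = cong (_·ₘ m) (renPV-id h t)
  renPV-id h (ƛ t)        = cong ƛ (renPV-id (ext-id h) t)
  renPV-id h (Λ t)        = cong Λ (renPV-id h t)
  renPV-id h ⟨ t , s ⟩    = cong₂ ⟨_,_⟩ (renPV-id h t) (renPV-id h s)
  renPV-id h (π₀ t)       = cong π₀ (renPV-id h t)
  renPV-id h (π₁ t)       = cong π₁ (renPV-id h t)
  renPV-id h (ι₀ t)       = cong ι₀ (renPV-id h t)
  renPV-id h (ι₁ t)       = cong ι₁ (renPV-id h t)
  renPV-id h (case t s r) =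
    cong₂ (_$_) (cong₂ case (renPV-id h t) (renPV-id (ext-id h) s)) (renPV-id (ext-id h) r)
  renPV-id h (pair m t)   = cong (pair m) (renPV-id h t)
  renPV-id h (unpack t s) = cong₂ unpack (renPV-id h t) (renPV-id (ext-id h) s)
  renPV-id h (em0 t s)    = cong₂ em0 (renPV-id h t) (renPV-id h s)
  renPV-id h (em1 t s)    = cong₂ em1 (renPV-id (ext-id h) t) (renPV-id (ext-id h) s)
  renPV-id h (Hyp i A)    = cong (λ j → Hyp j A) (h i)
  renPV-id h (Wit i A)    = cong (λ j → Wit j A) (h i)
  renPV-id h (H0 A)       = refl

  ⊢-wk-∷ʳ : ∀ {Γ t A P} → Γ ⊢ t ⦂ A → (Γ ++ [ hyp P ]) ⊢ t ⦂ A
  ⊢-wk-∷ʳ {t = t} d = subst (_ ⊢_⦂ _) (renPV-id (λ _ → refl) t)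
    (⊢-renPV id d (mkRenaming λ _ x _ → ∋-++⁺ˡ x) (λ _ → ∈-++⁺ˡ))

  ⊢-wk : ∀ {Γ t A} e → Γ ⊢ t ⦂ A → (e ∷ Γ) ⊢ renPV suc t ⦂ A
  ⊢-wk e d = ⊢-renPV suc d (mkRenaming λ _ x _ → there x) (λ _ → there)

  look-hit⇒≡ : ∀ k i → look k i ≡ hit → i ≡ k
  look-hit⇒≡ zero    zero    _  = refl
  look-hit⇒≡ (suc k) (suc i) eq with look k i in eq'
  ... | hit = cong suc (look-hit⇒≡ k i eq')

  look-self : ∀ k → look k k ≡ hit
  look-self zero                        = refl
  look-self (suc k) rewrite look-self k = refl

  look-keep⇒≢ : ∀ {k i j} → look k i ≡ keep j → i ≢ k
  look-keep⇒≢ {k} eq refl with () ← trans (sym (look-self k)) eq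

  look-≢ : ∀ k i → i ≢ k → Σ ℕ λ j → look k i ≡ keep j
  look-≢ k i i≢k with look k i in eq
  ... | hit    = ⊥-elim (i≢k (look-hit⇒≡ k i eq))
  ... | keep j = j , refl

  lowerIdx-keep : ∀ k i {j} → look k i ≡ keep j → lowerIdx k i ≡ j
  lowerIdx-keep k i eq rewrite eq = refl

  look-suc : ∀ k i {j} → look k i ≡ keep j → look (suc k) (suc i) ≡ keep (suc j)
  look-suc k i eq rewrite eq = refl

  lowerIdx-suc : ∀ k i → i ≢ k → lowerIdx (suc k) (suc i) ≡ suc (lowerIdx k i)
  lowerIdx-suc k i i≢k with j , eq ← look-≢ k i i≢k =
    trans (lowerIdx-keep (suc k) (suc i) (look-suc k i eq)) (cong suc (sym (lowerIdx-keep k i eq)))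

  ∋-distinct : ∀ {Γ i j e e'} → Γ ∋ i ⦂ e → Γ ∋ j ⦂ e' → e ≢ e' → i ≢ j
  ∋-distinct x y e≢e' refl = e≢e' (∋-functional x y)

  Removes : ℕ → Ctx → Ctx → Set
  Removes k = Renaming (_≢ k) (lowerIdx k)

  Removes-∷ : ∀ {k Γ Δ} e → Removes k Γ Δ → Removes (suc k) (e ∷ Γ) (e ∷ Δ)
  Removes-∷ {k} e r =
    Renaming-∷ e r (λ j j≢k → j≢k ∘ cong suc , lowerIdx-suc k j (j≢k ∘ cong suc)) refl

  Removes-head : ∀ {Γ Δ e'} → (∀ {i e} → Γ ∋ i ⦂ e → Δ ∋ i ⦂ e) → Removes 0 (e' ∷ Γ) Δ
  Removes-head {Γ} {Δ} {e'} Γ⊆Δ = mkRenaming go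
    where
    go : ∀ {i e} → i ≢ 0 → (e' ∷ Γ) ∋ i ⦂ e → ¬ NegHyp e → Δ ∋ lowerIdx 0 i ⦂ e
    go i≢0 here      _ = ⊥-elim (i≢0 refl)
    go _   (there x) _ = Γ⊆Δ x

  Removes-keep : ∀ {k Γ Δ i j e} → Removes k Γ Δ → look k i ≡ keep j →
                 Γ ∋ i ⦂ e → ¬ NegHyp e → Δ ∋ j ⦂ e
  Removes-keep {k} {i = i} r eq x nh =
    subst (λ j → _ ∋ j ⦂ _) (lowerIdx-keep k i eq) (rename-∋ r (look-keep⇒≢ eq) x nh)

  ⊢-substPV : ∀ {Γ Δ t A k u B} → Γ ⊢ t ⦂ A → Γ ∋ k ⦂ prf B → Δ ⊢ u ⦂ B →
              Removes k Γ Δ → NegHyps⊆ Γ Δ → Δ ⊢ substPV k u t ⦂ A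
  ⊢-substPV {k = k} (ax {i = i} x) kx du r Γ⊆Δ with look k i in eq
  ... | hit with refl ← look-hit⇒≡ k i eq with refl ← ∋-functional x kx = du
  ... | keep j = ax (Removes-keep r eq x λ ())
  ⊢-substPV (∧I d e)       kx du r Γ⊆Δ = ∧I (⊢-substPV d kx du r Γ⊆Δ) (⊢-substPV e kx du r Γ⊆Δ)
  ⊢-substPV (∧E₀ d)        kx du r Γ⊆Δ = ∧E₀ (⊢-substPV d kx du r Γ⊆Δ)
  ⊢-substPV (∧E₁ d)        kx du r Γ⊆Δ = ∧E₁ (⊢-substPV d kx du r Γ⊆Δ)
  ⊢-substPV (⇒E d e)       kx du r Γ⊆Δ = ⇒E (⊢-substPV d kx du r Γ⊆Δ) (⊢-substPV e kx du r Γ⊆Δ)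
  ⊢-substPV (⇒I d)         kx du r Γ⊆Δ =
    ⇒I (⊢-substPV d (there kx) (⊢-wk _ du) (Removes-∷ _ r) (NegHyps⊆-∷ _ Γ⊆Δ))
  ⊢-substPV (∨I₀ d)        kx du r Γ⊆Δ = ∨I₀ (⊢-substPV d kx du r Γ⊆Δ)
  ⊢-substPV (∨I₁ d)        kx du r Γ⊆Δ = ∨I₁ (⊢-substPV d kx du r Γ⊆Δ)
  ⊢-substPV (∨E d e f)     kx du r Γ⊆Δ = ∨E (⊢-substPV d kx du r Γ⊆Δ)
    (⊢-substPV e (there kx) (⊢-wk _ du) (Removes-∷ _ r) (NegHyps⊆-∷ _ Γ⊆Δ))
    (⊢-substPV f (there kx) (⊢-wk _ du) (Removes-∷ _ r) (NegHyps⊆-∷ _ Γ⊆Δ))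
  ⊢-substPV (∀E m d)       kx du r Γ⊆Δ = ∀E m (⊢-substPV d kx du r Γ⊆Δ)
  ⊢-substPV (∀I d)         kx du r Γ⊆Δ =
    ∀I (⊢-substPV d (∋-map⁺ (renE suc) kx) (⊢-wkFO du) (Renaming-⇑ r) (NegHyps⊆-⇑ Γ⊆Δ))
  ⊢-substPV (∃I m d)       kx du r Γ⊆Δ = ∃I m (⊢-substPV d kx du r Γ⊆Δ)
  ⊢-substPV (∃E d e)       kx du r Γ⊆Δ = ∃E (⊢-substPV d kx du r Γ⊆Δ)
    (⊢-substPV e (there (∋-map⁺ (renE suc) kx)) (⊢-wk _ (⊢-wkFO du))
               (Removes-∷ _ (Renaming-⇑ r)) (NegHyps⊆-∷ _ (NegHyps⊆-⇑ Γ⊆Δ)))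
  ⊢-substPV (H-ax s x)     kx du r Γ⊆Δ = H-ax s (rename-∋ r (∋-distinct x kx λ ()) x ¬NegProp-∀)
  ⊢-substPV (W-ax s x)     kx du r Γ⊆Δ = W-ax s (rename-∋ r (∋-distinct x kx λ ()) x ¬NegProp-∃)
  ⊢-substPV (H0-ax s x)    kx du r Γ⊆Δ = H0-ax s (Γ⊆Δ s x)
  ⊢-substPV (H0-efq s)     kx du r Γ⊆Δ = H0-efq s
  ⊢-substPV (EM0 s d e)    kx du r Γ⊆Δ = EM0 s
    (⊢-substPV d (∋-++⁺ˡ kx) (⊢-wk-∷ʳ du) (Renaming-∷ʳ (np-⇒ s np-⊥) r) (NegHyps⊆-∷ʳ _ Γ⊆Δ))
    (⊢-substPV e (∋-++⁺ˡ kx) (⊢-wk-∷ʳ du) (Renaming-∷ʳ s r) (NegHyps⊆-∷ʳ _ Γ⊆Δ))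
  ⊢-substPV (EM1 s s' d e) kx du r Γ⊆Δ = EM1 s s'
    (⊢-substPV d (there kx) (⊢-wk _ du) (Removes-∷ _ r) (NegHyps⊆-∷ _ Γ⊆Δ))
    (⊢-substPV e (there kx) (⊢-wk _ du) (Removes-∷ _ r) (NegHyps⊆-∷ _ Γ⊆Δ))

  ∈-inst-⇑ : ∀ {Δ R m} → hyp (R [ m ]F) ∈ Δ → hyp (renF (ext suc) R [ renT suc m ]F) ∈ ⇑ Δ
  ∈-inst-⇑ {R = R} {m} x = subst (λ A → hyp A ∈ _) (renF-inst suc R m) (∈-map⁺ (renE suc) x)

  ⊢-exW : ∀ {Γ Δ v A k m R} → Γ ⊢ v ⦂ A → Γ ∋ k ⦂ hyp (∃f R) → NegProp R →
          hyp (R [ m ]F) ∈ Δ → Removes k Γ Δ → NegHyps⊆ Γ Δ → Δ ⊢ exW k m v ⦂ A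
  ⊢-exW (ax x)         kx p Rm r Γ⊆Δ = ax (rename-∋ r (∋-distinct x kx λ ()) x λ ())
  ⊢-exW (∧I d e)       kx p Rm r Γ⊆Δ = ∧I (⊢-exW d kx p Rm r Γ⊆Δ) (⊢-exW e kx p Rm r Γ⊆Δ)
  ⊢-exW (∧E₀ d)        kx p Rm r Γ⊆Δ = ∧E₀ (⊢-exW d kx p Rm r Γ⊆Δ)
  ⊢-exW (∧E₁ d)        kx p Rm r Γ⊆Δ = ∧E₁ (⊢-exW d kx p Rm r Γ⊆Δ)
  ⊢-exW (⇒E d e)       kx p Rm r Γ⊆Δ = ⇒E (⊢-exW d kx p Rm r Γ⊆Δ) (⊢-exW e kx p Rm r Γ⊆Δ)
  ⊢-exW (⇒I d)         kx p Rm r Γ⊆Δ =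
    ⇒I (⊢-exW d (there kx) p (there Rm) (Removes-∷ _ r) (NegHyps⊆-∷ _ Γ⊆Δ))
  ⊢-exW (∨I₀ d)        kx p Rm r Γ⊆Δ = ∨I₀ (⊢-exW d kx p Rm r Γ⊆Δ)
  ⊢-exW (∨I₁ d)        kx p Rm r Γ⊆Δ = ∨I₁ (⊢-exW d kx p Rm r Γ⊆Δ)
  ⊢-exW (∨E d e f)     kx p Rm r Γ⊆Δ = ∨E (⊢-exW d kx p Rm r Γ⊆Δ)
    (⊢-exW e (there kx) p (there Rm) (Removes-∷ _ r) (NegHyps⊆-∷ _ Γ⊆Δ))
    (⊢-exW f (there kx) p (there Rm) (Removes-∷ _ r) (NegHyps⊆-∷ _ Γ⊆Δ))
  ⊢-exW (∀E n d)       kx p Rm r Γ⊆Δ = ∀E n (⊢-exW d kx p Rm r Γ⊆Δ)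
  ⊢-exW (∀I d)         kx p Rm r Γ⊆Δ = ∀I (⊢-exW d (∋-map⁺ (renE suc) kx) (NegProp-renF _ p)
                                            (∈-inst-⇑ Rm) (Renaming-⇑ r) (NegHyps⊆-⇑ Γ⊆Δ))
  ⊢-exW (∃I n d)       kx p Rm r Γ⊆Δ = ∃I n (⊢-exW d kx p Rm r Γ⊆Δ)
  ⊢-exW (∃E d e)       kx p Rm r Γ⊆Δ = ∃E (⊢-exW d kx p Rm r Γ⊆Δ)
    (⊢-exW e (there (∋-map⁺ (renE suc) kx)) (NegProp-renF _ p) (there (∈-inst-⇑ Rm))
             (Removes-∷ _ (Renaming-⇑ r)) (NegHyps⊆-∷ _ (NegHyps⊆-⇑ Γ⊆Δ)))
  ⊢-exW (H-ax s x)     kx p Rm r Γ⊆Δ = H-ax s (rename-∋ r (∋-distinct x kx λ ()) x ¬NegProp-∀)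
  ⊢-exW {k = k} (W-ax {i = i} s x) kx p Rm r Γ⊆Δ with look k i in eq
  ... | hit with refl ← look-hit⇒≡ k i eq with refl ← ∋-functional x kx = ∃I _ (H0-ax (NegProp-subF _ p) Rm)
  ... | keep j = W-ax s (Removes-keep r eq x ¬NegProp-∃)
  ⊢-exW (H0-ax s x)    kx p Rm r Γ⊆Δ = H0-ax s (Γ⊆Δ s x)
  ⊢-exW (H0-efq s)     kx p Rm r Γ⊆Δ = H0-efq s
  ⊢-exW (EM0 s d e)    kx p Rm r Γ⊆Δ = EM0 s
    (⊢-exW d (∋-++⁺ˡ kx) p (∈-++⁺ˡ Rm) (Renaming-∷ʳ (np-⇒ s np-⊥) r) (NegHyps⊆-∷ʳ _ Γ⊆Δ))
    (⊢-exW e (∋-++⁺ˡ kx) p (∈-++⁺ˡ Rm) (Renaming-∷ʳ s r) (NegHyps⊆-∷ʳ _ Γ⊆Δ))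
  ⊢-exW (EM1 s s' d e) kx p Rm r Γ⊆Δ = EM1 s s'
    (⊢-exW d (there kx) p (there Rm) (Removes-∷ _ r) (NegHyps⊆-∷ _ Γ⊆Δ))
    (⊢-exW e (there kx) p (there Rm) (Removes-∷ _ r) (NegHyps⊆-∷ _ Γ⊆Δ))

  ⊢-ExH : ∀ {Γ k m u u' A P} → ExH k m u u' → Γ ⊢ u ⦂ A → Γ ∋ k ⦂ hyp (∀f P) →
          NegProp P → hyp (P [ m ]F) ∈ Γ → Γ ⊢ u' ⦂ A
  ⊢-ExH ex-hit (∀E _ (H-ax s x)) kx p Pm with refl ← ∋-functional x kx = H0-ax (NegProp-subF _ p) Pm
  ⊢-ExH (ex-appₘ _ e)       (∀E n d)      kx p Pm = ∀E n (⊢-ExH e d kx p Pm)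
  ⊢-ExH ex-pv               d             kx p Pm = d
  ⊢-ExH (ex-app e e')       (⇒E d d')     kx p Pm = ⇒E (⊢-ExH e d kx p Pm) (⊢-ExH e' d' kx p Pm)
  ⊢-ExH (ex-ƛ e)            (⇒I d)        kx p Pm = ⇒I (⊢-ExH e d (there kx) p (there Pm))
  ⊢-ExH (ex-Λ e)            (∀I d)        kx p Pm =
    ∀I (⊢-ExH e d (∋-map⁺ (renE suc) kx) (NegProp-renF _ p) (∈-inst-⇑ Pm))
  ⊢-ExH (ex-⟨⟩ e e')        (∧I d d')     kx p Pm = ∧I (⊢-ExH e d kx p Pm) (⊢-ExH e' d' kx p Pm)
  ⊢-ExH (ex-π₀ e)           (∧E₀ d)       kx p Pm = ∧E₀ (⊢-ExH e d kx p Pm)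
  ⊢-ExH (ex-π₁ e)           (∧E₁ d)       kx p Pm = ∧E₁ (⊢-ExH e d kx p Pm)
  ⊢-ExH (ex-ι₀ e)           (∨I₀ d)       kx p Pm = ∨I₀ (⊢-ExH e d kx p Pm)
  ⊢-ExH (ex-ι₁ e)           (∨I₁ d)       kx p Pm = ∨I₁ (⊢-ExH e d kx p Pm)
  ⊢-ExH (ex-case e e' e'')  (∨E d d' d'') kx p Pm =
    ∨E (⊢-ExH e d kx p Pm) (⊢-ExH e' d' (there kx) p (there Pm)) (⊢-ExH e'' d'' (there kx) p (there Pm))
  ⊢-ExH (ex-pair e)         (∃I n d)      kx p Pm = ∃I n (⊢-ExH e d kx p Pm)
  ⊢-ExH (ex-unp e e')       (∃E d d')     kx p Pm = ∃E (⊢-ExH e d kx p Pm)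
    (⊢-ExH e' d' (there (∋-map⁺ (renE suc) kx)) (NegProp-renF _ p) (there (∈-inst-⇑ Pm)))
  ⊢-ExH (ex-em0 e e')       (EM0 s d d')  kx p Pm =
    EM0 s (⊢-ExH e d (∋-++⁺ˡ kx) p (∈-++⁺ˡ Pm)) (⊢-ExH e' d' (∋-++⁺ˡ kx) p (∈-++⁺ˡ Pm))
  ⊢-ExH (ex-em1 e e')       (EM1 s s' d d') kx p Pm =
    EM1 s s' (⊢-ExH e d (there kx) p (there Pm)) (⊢-ExH e' d' (there kx) p (there Pm))
  ⊢-ExH ex-Hyp              d             kx p Pm = d
  ⊢-ExH ex-Wit              d             kx p Pm = d
  ⊢-ExH ex-H0               d             kx p Pm = d

  -- Subject reduction

  NegHyps⊆-head : ∀ {Γ Δ e} → ¬ NegHyp e → (∀ {P} → hyp P ∈ Γ → hyp P ∈ Δ) →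
                  NegHyps⊆ (e ∷ Γ) Δ
  NegHyps⊆-head nh Γ⊆Δ p (here refl) = ⊥-elim (nh p)
  NegHyps⊆-head nh Γ⊆Δ p (there x)   = Γ⊆Δ x

  ⊢-subst₀ : ∀ {Γ t u A B} → (prf B ∷ Γ) ⊢ t ⦂ A → Γ ⊢ u ⦂ B → Γ ⊢ substPV 0 u t ⦂ A
  ⊢-subst₀ d e = ⊢-substPV d here e (Removes-head id) (NegHyps⊆-head (λ ()) id)

  ⊢-strengthen : ∀ {Γ e u A} → (e ∷ Γ) ⊢ u ⦂ A → ¬ Free 0 u → ¬ NegHyp e →
                 Γ ⊢ renPV pred u ⦂ A
  ⊢-strengthen {Γ} {e} {u} d 0∉u nh = ⊢-renPV pred d (mkRenaming go) (NegHyps⊆-head nh id)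
    where
    go : ∀ {i e'} → Free i u → (e ∷ Γ) ∋ i ⦂ e' → ¬ NegHyp e' → Γ ∋ pred i ⦂ e'
    go i∈u here      _ = ⊥-elim (0∉u i∈u)
    go _   (there x) _ = x

  subject-reduction-⟶ : ∀ {Γ t t' A} → t ⟶ t' → Γ ⊢ t ⦂ A → Γ ⊢ t' ⦂ A
  subject-reduction-⟶ β-ƛ  (⇒E (⇒I d) e)       = ⊢-subst₀ d e
  subject-reduction-⟶ β-Λ  (∀E m (∀I d))       = ⊢-cast (inst-⇑ m _) refl (⊢-subFO (m • var) d)
  subject-reduction-⟶ β-π₀ (∧E₀ (∧I d e))      = d
  subject-reduction-⟶ β-π₁ (∧E₁ (∧I d e))      = e
  subject-reduction-⟶ β-ι₀ (∨E (∨I₀ d) e f)    = ⊢-subst₀ e d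
  subject-reduction-⟶ β-ι₁ (∨E (∨I₁ d) e f)    = ⊢-subst₀ f d
  subject-reduction-⟶ β-∃  (∃E {C = C} (∃I m d) e) =
    ⊢-subst₀ (⊢-cast (cong (_ ∷_) (inst-⇑ m _)) (inst-wk m C) (⊢-subFO (m • var) e)) d
  subject-reduction-⟶ p-app    (⇒E (EM0 s d₁ d₂) e)   =
    EM0 s (⇒E d₁ (⊢-wk-∷ʳ e)) (⇒E d₂ (⊢-wk-∷ʳ e))
  subject-reduction-⟶ p-appₘ   (∀E m (EM0 s d₁ d₂))   = EM0 s (∀E m d₁) (∀E m d₂)
  subject-reduction-⟶ p-π₀     (∧E₀ (EM0 s d₁ d₂))    = EM0 s (∧E₀ d₁) (∧E₀ d₂)
  subject-reduction-⟶ p-π₁     (∧E₁ (EM0 s d₁ d₂))    = EM0 s (∧E₁ d₁) (∧E₁ d₂)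
  subject-reduction-⟶ p-case   (∨E (EM0 s d₁ d₂) e f) =
    EM0 s (∨E d₁ (⊢-wk-∷ʳ e) (⊢-wk-∷ʳ f)) (∨E d₂ (⊢-wk-∷ʳ e) (⊢-wk-∷ʳ f))
  subject-reduction-⟶ {Γ} p-unpack (∃E (EM0 s d₁ d₂) e) =
    EM0 s (∃E d₁ (⊢-cast ⇑-∷ʳ refl (⊢-wk-∷ʳ e))) (∃E d₂ (⊢-cast ⇑-∷ʳ refl (⊢-wk-∷ʳ e)))
    where
    ⇑-∷ʳ : ∀ {e P} → e ∷ (⇑ Γ ++ [ hyp (renF suc P) ]) ≡ e ∷ ⇑ (Γ ++ [ hyp P ])
    ⇑-∷ʳ = cong (_ ∷_) (sym (map-++ (renE suc) Γ _))
  subject-reduction-⟶ (em1-drop 0∉u) (EM1 s s' d e) = ⊢-strengthen d 0∉u ¬NegProp-∀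
  subject-reduction-⟶ {Γ} (em1-exc _ ex) (EM1 s s' d e) =
    EM0 (NegProp-subF _ s)
      (⊢-exW e here (np-⇒ s np-⊥) (∈-++⁺ʳ Γ (here refl)) (Removes-head ∋-++⁺ˡ)
             (NegHyps⊆-head ¬NegProp-∃ ∈-++⁺ˡ))
      (EM1 s s' (⊢-ExH ex (⊢-wk-∷ʳ d) here s (there (∈-++⁺ʳ Γ (here refl)))) (⊢-wk-∷ʳ e))

  subject-reduction : ∀ {Γ t t' A} → t ↦ t' → Γ ⊢ t ⦂ A → Γ ⊢ t' ⦂ A
  subject-reduction (top r)    d              = subject-reduction-⟶ r d
  subject-reduction (app₁ r)   (⇒E d e)       = ⇒E (subject-reduction r d) e
  subject-reduction (app₂ r)   (⇒E d e)       = ⇒E d (subject-reduction r e)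
  subject-reduction (appₘ r)   (∀E m d)       = ∀E m (subject-reduction r d)
  subject-reduction (ƛ-c r)    (⇒I d)         = ⇒I (subject-reduction r d)
  subject-reduction (Λ-c r)    (∀I d)         = ∀I (subject-reduction r d)
  subject-reduction (⟨⟩₁ r)    (∧I d e)       = ∧I (subject-reduction r d) e
  subject-reduction (⟨⟩₂ r)    (∧I d e)       = ∧I d (subject-reduction r e)
  subject-reduction (π₀-c r)   (∧E₀ d)        = ∧E₀ (subject-reduction r d)
  subject-reduction (π₁-c r)   (∧E₁ d)        = ∧E₁ (subject-reduction r d)
  subject-reduction (ι₀-c r)   (∨I₀ d)        = ∨I₀ (subject-reduction r d)
  subject-reduction (ι₁-c r)   (∨I₁ d)        = ∨I₁ (subject-reduction r d)
  subject-reduction (case₁ r)  (∨E d e f)     = ∨E (subject-reduction r d) e f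
  subject-reduction (case₂ r)  (∨E d e f)     = ∨E d (subject-reduction r e) f
  subject-reduction (case₃ r)  (∨E d e f)     = ∨E d e (subject-reduction r f)
  subject-reduction (pair-c r) (∃I m d)       = ∃I m (subject-reduction r d)
  subject-reduction (unp₁ r)   (∃E d e)       = ∃E (subject-reduction r d) e
  subject-reduction (unp₂ r)   (∃E d e)       = ∃E d (subject-reduction r e)
  subject-reduction (em0₁ r)   (EM0 s d e)    = EM0 s (subject-reduction r d) e
  subject-reduction (em0₂ r)   (EM0 s d e)    = EM0 s d (subject-reduction r e)
  subject-reduction (em1₁ r)   (EM1 s s' d e) = EM1 s s' (subject-reduction r d) e
  subject-reduction (em1₂ r)   (EM1 s s' d e) = EM1 s s' d (subject-reduction r e)

  subject-reduction* : ∀ {Γ t t' A} → t ↦* t' → Γ ⊢ t ⦂ A → Γ ⊢ t' ⦂ A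
  subject-reduction* ε        d = d
  subject-reduction* (r ◅ rs) d = subject-reduction* rs (subject-reduction r d)

  -- Preservation of quasi-closedness

  occT-subT : ∀ σ m n → occT n (subT σ m) → Σ ℕ λ j → occT j m × occT n (σ j)
  occV-subV : ∀ {k} σ (ms : Vec Tm k) n → occV n (subV σ ms) → Σ ℕ λ j → occV j ms × occT n (σ j)
  occT-subT σ (var x)    n o = x , refl , o
  occT-subT σ (fun f ts) n o = occV-subV σ ts n o
  occV-subV σ (t ∷ ts) n (inj₁ o) with j , o' , o'' ← occT-subT σ t n o  = j , inj₁ o' , o''
  occV-subV σ (t ∷ ts) n (inj₂ o) with j , o' , o'' ← occV-subV σ ts n o = j , inj₂ o' , o''

  occT-renT : ∀ ρ m n → occT n m → occT (ρ n) (renT ρ m)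
  occV-renV : ∀ {k} ρ (ms : Vec Tm k) n → occV n ms → occV (ρ n) (renV ρ ms)
  occT-renT ρ (var x)    n refl     = refl
  occT-renT ρ (fun f ts) n o        = occV-renV ρ ts n o
  occV-renV ρ (t ∷ ts)   n (inj₁ o) = inj₁ (occT-renT ρ t n o)
  occV-renV ρ (t ∷ ts)   n (inj₂ o) = inj₂ (occV-renV ρ ts n o)

  occT-renT⁻ : ∀ ρ m n → occT n (renT ρ m) → Σ ℕ λ j → occT j m × n ≡ ρ j
  occV-renV⁻ : ∀ {k} ρ (ms : Vec Tm k) n → occV n (renV ρ ms) → Σ ℕ λ j → occV j ms × n ≡ ρ j
  occT-renT⁻ ρ (var x)    n refl = x , refl , refl
  occT-renT⁻ ρ (fun f ts) n o    = occV-renV⁻ ρ ts n o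
  occV-renV⁻ ρ (t ∷ ts) n (inj₁ o) with j , o' , eq ← occT-renT⁻ ρ t n o  = j , inj₁ o' , eq
  occV-renV⁻ ρ (t ∷ ts) n (inj₂ o) with j , o' , eq ← occV-renV⁻ ρ ts n o = j , inj₂ o' , eq

  occT-exts⁻ : ∀ σ j n → occT (suc n) (exts σ j) → Σ ℕ λ j' → j ≡ suc j' × occT n (σ j')
  occT-exts⁻ σ (suc j) n o with _ , o' , refl ← occT-renT⁻ suc (σ j) (suc n) o = j , refl , o'

  occF-subF : ∀ σ A n → occF n (subF σ A) → Σ ℕ λ j → occF j A × occT n (σ j)
  occF-subF σ (atom p ts) n o        = occV-subV σ ts n o
  occF-subF σ (A ∧f B)    n (inj₁ o) = map₂ (map₁ inj₁) (occF-subF σ A n o)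
  occF-subF σ (A ∧f B)    n (inj₂ o) = map₂ (map₁ inj₂) (occF-subF σ B n o)
  occF-subF σ (A ∨f B)    n (inj₁ o) = map₂ (map₁ inj₁) (occF-subF σ A n o)
  occF-subF σ (A ∨f B)    n (inj₂ o) = map₂ (map₁ inj₂) (occF-subF σ B n o)
  occF-subF σ (A ⇒f B)    n (inj₁ o) = map₂ (map₁ inj₁) (occF-subF σ A n o)
  occF-subF σ (A ⇒f B)    n (inj₂ o) = map₂ (map₁ inj₂) (occF-subF σ B n o)
  occF-subF σ (∀f A)      n o
    with j , oA , oσ ← occF-subF (exts σ) A (suc n) o
    with j' , refl , o' ← occT-exts⁻ σ j n oσ = j' , oA , o'
  occF-subF σ (∃f A)      n o
    with j , oA , oσ ← occF-subF (exts σ) A (suc n) o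
    with j' , refl , o' ← occT-exts⁻ σ j n oσ = j' , oA , o'

  -- Quasi-closedness without the requirement that free H-variables be simply
  -- universal, which typing provides wherever it is needed.
  HypClosed : ℕ → ℕ → PT → Set
  HypClosed p d (pv i)       = i < p
  HypClosed p d (t · s)      = HypClosed p d t × HypClosed p d s
  HypClosed p d (t ·ₘ m)     = HypClosed p d t × BoundT d m
  HypClosed p d (ƛ t)        = HypClosed (suc p) d t
  HypClosed p d (Λ t)        = HypClosed p (suc d) t
  HypClosed p d ⟨ t , s ⟩    = HypClosed p d t × HypClosed p d s
  HypClosed p d (π₀ t)       = HypClosed p d t
  HypClosed p d (π₁ t)       = HypClosed p d t
  HypClosed p d (ι₀ t)       = HypClosed p d t
  HypClosed p d (ι₁ t)       = HypClosed p d t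
  HypClosed p d (case t s r) = HypClosed p d t × (HypClosed (suc p) d s × HypClosed (suc p) d r)
  HypClosed p d (pair m t)   = BoundT d m × HypClosed p d t
  HypClosed p d (unpack t s) = HypClosed p d t × HypClosed (suc p) (suc d) s
  HypClosed p d (em0 t s)    = HypClosed p d t × HypClosed p d s
  HypClosed p d (em1 t s)    = HypClosed (suc p) d t × HypClosed (suc p) d s
  HypClosed p d (Hyp i A)    = BoundF (suc d) A
  HypClosed p d (Wit i P)    = BoundF (suc d) P × i < p
  HypClosed p d (H0 P)       = BoundF d P

  QC⇒HypClosed : ∀ p d t → QC p d t → HypClosed p d t
  QC⇒HypClosed p d (pv i)       q           = q
  QC⇒HypClosed p d (t · s)      (a , b)     = QC⇒HypClosed p d t a , QC⇒HypClosed p d s b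
  QC⇒HypClosed p d (t ·ₘ m)     (a , b)     = QC⇒HypClosed p d t a , b
  QC⇒HypClosed p d (ƛ t)        q           = QC⇒HypClosed (suc p) d t q
  QC⇒HypClosed p d (Λ t)        q           = QC⇒HypClosed p (suc d) t q
  QC⇒HypClosed p d ⟨ t , s ⟩    (a , b)     = QC⇒HypClosed p d t a , QC⇒HypClosed p d s b
  QC⇒HypClosed p d (π₀ t)       q           = QC⇒HypClosed p d t q
  QC⇒HypClosed p d (π₁ t)       q           = QC⇒HypClosed p d t q
  QC⇒HypClosed p d (ι₀ t)       q           = QC⇒HypClosed p d t q
  QC⇒HypClosed p d (ι₁ t)       q           = QC⇒HypClosed p d t q
  QC⇒HypClosed p d (case t s r) (a , b , c) =
    QC⇒HypClosed p d t a , QC⇒HypClosed (suc p) d s b , QC⇒HypClosed (suc p) d r c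
  QC⇒HypClosed p d (pair m t)   (a , b)     = a , QC⇒HypClosed p d t b
  QC⇒HypClosed p d (unpack t s) (a , b)     = QC⇒HypClosed p d t a , QC⇒HypClosed (suc p) (suc d) s b
  QC⇒HypClosed p d (em0 t s)    (a , b)     = QC⇒HypClosed p d t a , QC⇒HypClosed p d s b
  QC⇒HypClosed p d (em1 t s)    (a , b)     = QC⇒HypClosed (suc p) d t a , QC⇒HypClosed (suc p) d s b
  QC⇒HypClosed p d (Hyp i A)    (a , _)     = a
  QC⇒HypClosed p d (Wit i P)    q           = q
  QC⇒HypClosed p d (H0 P)       q           = q

  BoundedSub : ℕ → ℕ → (ℕ → Tm) → Set
  BoundedSub d d' σ = ∀ j → j < d → BoundT d' (σ j)

  BoundT-subT : ∀ {d d' σ} m → BoundT d m → BoundedSub d d' σ → BoundT d' (subT σ m)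
  BoundT-subT {σ = σ} m bm bσ n o with j , oj , o' ← occT-subT σ m n o = bσ j (bm j oj) n o'

  BoundF-subF : ∀ {d d' σ} A → BoundF d A → BoundedSub d d' σ → BoundF d' (subF σ A)
  BoundF-subF {σ = σ} A bA bσ n o with j , oj , o' ← occF-subF σ A n o = bσ j (bA j oj) n o'

  BoundedSub-exts : ∀ {d d' σ} → BoundedSub d d' σ → BoundedSub (suc d) (suc d') (exts σ)
  BoundedSub-exts bσ zero    _         n refl = s≤s z≤n
  BoundedSub-exts {σ = σ} bσ (suc j) (s≤s j<d) n o
    with n' , o' , refl ← occT-renT⁻ suc (σ j) n o = s≤s (bσ j j<d n' o')

  BoundedSub-inst : ∀ {d m} → BoundT d m → BoundedSub (suc d) d (m • var)
  BoundedSub-inst bm zero    _         = bm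
  BoundedSub-inst bm (suc j) (s≤s j<d) n refl = j<d

  BoundT-wk : ∀ {d} m → BoundT d m → BoundT (suc d) (renT suc m)
  BoundT-wk m bm n o with n' , o' , refl ← occT-renT⁻ suc m n o = s≤s (bm n' o')

  HypClosed-subFO : ∀ {p d d'} σ t → HypClosed p d t → BoundedSub d d' σ → HypClosed p d' (subFO σ t)
  HypClosed-subFO σ (pv i)       q           bσ = q
  HypClosed-subFO σ (t · s)      (a , b)     bσ = HypClosed-subFO σ t a bσ , HypClosed-subFO σ s b bσ
  HypClosed-subFO σ (t ·ₘ m)     (a , b)     bσ = HypClosed-subFO σ t a bσ , BoundT-subT m b bσ
  HypClosed-subFO σ (ƛ t)        q           bσ = HypClosed-subFO σ t q bσ
  HypClosed-subFO σ (Λ t)        q           bσ = HypClosed-subFO (exts σ) t q (BoundedSub-exts bσ)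
  HypClosed-subFO σ ⟨ t , s ⟩    (a , b)     bσ = HypClosed-subFO σ t a bσ , HypClosed-subFO σ s b bσ
  HypClosed-subFO σ (π₀ t)       q           bσ = HypClosed-subFO σ t q bσ
  HypClosed-subFO σ (π₁ t)       q           bσ = HypClosed-subFO σ t q bσ
  HypClosed-subFO σ (ι₀ t)       q           bσ = HypClosed-subFO σ t q bσ
  HypClosed-subFO σ (ι₁ t)       q           bσ = HypClosed-subFO σ t q bσ
  HypClosed-subFO σ (case t s r) (a , b , c) bσ =
    HypClosed-subFO σ t a bσ , HypClosed-subFO σ s b bσ , HypClosed-subFO σ r c bσ
  HypClosed-subFO σ (pair m t)   (a , b)     bσ = BoundT-subT m a bσ , HypClosed-subFO σ t b bσ
  HypClosed-subFO σ (unpack t s) (a , b)     bσ =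
    HypClosed-subFO σ t a bσ , HypClosed-subFO (exts σ) s b (BoundedSub-exts bσ)
  HypClosed-subFO σ (em0 t s)    (a , b)     bσ = HypClosed-subFO σ t a bσ , HypClosed-subFO σ s b bσ
  HypClosed-subFO σ (em1 t s)    (a , b)     bσ = HypClosed-subFO σ t a bσ , HypClosed-subFO σ s b bσ
  HypClosed-subFO σ (Hyp i A)    q           bσ = BoundF-subF A q (BoundedSub-exts bσ)
  HypClosed-subFO σ (Wit i P)    (a , b)     bσ = BoundF-subF P a (BoundedSub-exts bσ) , b
  HypClosed-subFO σ (H0 P)       q           bσ = BoundF-subF P q bσ

  HypClosed-wkFO : ∀ {p d} t → HypClosed p d t → HypClosed p (suc d) (renFO suc t)
  HypClosed-wkFO t q = subst (HypClosed _ _) (sym (renFO≗subFO suc t))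
                             (HypClosed-subFO _ t q λ { j j<d n refl → s≤s j<d })

  ext-< : ∀ {ρ p p'} {F G : ℕ → Set} → (∀ i → F i → i < p → ρ i < p') → (∀ j → G (suc j) → F j) →
          ∀ i → G i → i < suc p → ext ρ i < suc p'
  ext-< ρ< G⇒F zero    _ _         = s≤s z≤n
  ext-< ρ< G⇒F (suc j) g (s≤s j<p) = s≤s (ρ< j (G⇒F j g) j<p)

  HypClosed-renPV : ∀ {p p' d} ρ t → HypClosed p d t → (∀ i → Free i t → i < p → ρ i < p') →
                    HypClosed p' d (renPV ρ t)
  HypClosed-renPV ρ (pv i)       q           ρ< = ρ< i refl q
  HypClosed-renPV ρ (t · s)      (a , b)     ρ< =
    HypClosed-renPV ρ t a (λ i → ρ< i ∘ inj₁) , HypClosed-renPV ρ s b (λ i → ρ< i ∘ inj₂)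
  HypClosed-renPV ρ (t ·ₘ m)     (a , b)     ρ< = HypClosed-renPV ρ t a ρ< , b
  HypClosed-renPV ρ (ƛ t)        q           ρ< = HypClosed-renPV (ext ρ) t q (ext-< ρ< λ _ f → f)
  HypClosed-renPV ρ (Λ t)        q           ρ< = HypClosed-renPV ρ t q ρ<
  HypClosed-renPV ρ ⟨ t , s ⟩    (a , b)     ρ< =
    HypClosed-renPV ρ t a (λ i → ρ< i ∘ inj₁) , HypClosed-renPV ρ s b (λ i → ρ< i ∘ inj₂)
  HypClosed-renPV ρ (π₀ t)       q           ρ< = HypClosed-renPV ρ t q ρ<
  HypClosed-renPV ρ (π₁ t)       q           ρ< = HypClosed-renPV ρ t q ρ<
  HypClosed-renPV ρ (ι₀ t)       q           ρ< = HypClosed-renPV ρ t q ρ<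
  HypClosed-renPV ρ (ι₁ t)       q           ρ< = HypClosed-renPV ρ t q ρ<
  HypClosed-renPV ρ (case t s r) (a , b , c) ρ< = HypClosed-renPV ρ t a (λ i → ρ< i ∘ inj₁) ,
    HypClosed-renPV (ext ρ) s b (ext-< ρ< λ _ → inj₂ ∘ inj₁) ,
    HypClosed-renPV (ext ρ) r c (ext-< ρ< λ _ → inj₂ ∘ inj₂)
  HypClosed-renPV ρ (pair m t)   (a , b)     ρ< = a , HypClosed-renPV ρ t b ρ<
  HypClosed-renPV ρ (unpack t s) (a , b)     ρ< =
    HypClosed-renPV ρ t a (λ i → ρ< i ∘ inj₁) , HypClosed-renPV (ext ρ) s b (ext-< ρ< λ _ → inj₂)
  HypClosed-renPV ρ (em0 t s)    (a , b)     ρ< =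
    HypClosed-renPV ρ t a (λ i → ρ< i ∘ inj₁) , HypClosed-renPV ρ s b (λ i → ρ< i ∘ inj₂)
  HypClosed-renPV ρ (em1 t s)    (a , b)     ρ< =
    HypClosed-renPV (ext ρ) t a (ext-< ρ< λ _ → inj₁) , HypClosed-renPV (ext ρ) s b (ext-< ρ< λ _ → inj₂)
  HypClosed-renPV ρ (Hyp i A)    q           ρ< = q
  HypClosed-renPV ρ (Wit i P)    (a , b)     ρ< = a , ρ< i refl b
  HypClosed-renPV ρ (H0 P)       q           ρ< = q

  HypClosed-wkPV : ∀ {p d} t → HypClosed p d t → HypClosed (suc p) d (renPV suc t)
  HypClosed-wkPV t q = HypClosed-renPV suc t q λ _ _ → s≤s

  lowerIdx-< : ∀ {p} k i → i ≢ k → i < suc p → k < suc p → lowerIdx k i < p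
  lowerIdx-<         zero    zero    i≢k _         _         = ⊥-elim (i≢k refl)
  lowerIdx-<         zero    (suc i) _   (s≤s i<p) _         = i<p
  lowerIdx-< {zero}  (suc k) i       _   _         (s≤s ())
  lowerIdx-< {suc p} (suc k) zero    _   _         _         = s≤s z≤n
  lowerIdx-< {suc p} (suc k) (suc i) i≢k (s≤s i<p) (s≤s k<p)
    rewrite lowerIdx-suc k i (i≢k ∘ cong suc) = s≤s (lowerIdx-< k i (i≢k ∘ cong suc) i<p k<p)

  HypClosed-substPV : ∀ {Γ t A k u B p d} → Γ ⊢ t ⦂ A → Γ ∋ k ⦂ prf B →
                      HypClosed (suc p) d t → k < suc p → HypClosed p d u →
                      HypClosed p d (substPV k u t)
  HypClosed-substPV {k = k} {p = p} (ax {i = i} x) kx q k<p qu with look k i in eq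
  ... | hit    = qu
  ... | keep j = subst (_< p) (lowerIdx-keep k i eq) (lowerIdx-< k i (look-keep⇒≢ eq) q k<p)
  HypClosed-substPV (∧I d e)       kx (a , b)     k<p qu =
    HypClosed-substPV d kx a k<p qu , HypClosed-substPV e kx b k<p qu
  HypClosed-substPV (∧E₀ d)        kx q           k<p qu = HypClosed-substPV d kx q k<p qu
  HypClosed-substPV (∧E₁ d)        kx q           k<p qu = HypClosed-substPV d kx q k<p qu
  HypClosed-substPV (⇒E d e)       kx (a , b)     k<p qu =
    HypClosed-substPV d kx a k<p qu , HypClosed-substPV e kx b k<p qu
  HypClosed-substPV {u = u} (⇒I d) kx q           k<p qu =
    HypClosed-substPV d (there kx) q (s≤s k<p) (HypClosed-wkPV u qu)
  HypClosed-substPV (∨I₀ d)        kx q           k<p qu = HypClosed-substPV d kx q k<p qu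
  HypClosed-substPV (∨I₁ d)        kx q           k<p qu = HypClosed-substPV d kx q k<p qu
  HypClosed-substPV {u = u} (∨E d e f) kx (a , b , c) k<p qu = HypClosed-substPV d kx a k<p qu ,
    HypClosed-substPV e (there kx) b (s≤s k<p) (HypClosed-wkPV u qu) ,
    HypClosed-substPV f (there kx) c (s≤s k<p) (HypClosed-wkPV u qu)
  HypClosed-substPV (∀E n d)       kx (a , b)     k<p qu = HypClosed-substPV d kx a k<p qu , b
  HypClosed-substPV {u = u} (∀I d) kx q           k<p qu =
    HypClosed-substPV d (∋-map⁺ (renE suc) kx) q k<p (HypClosed-wkFO u qu)
  HypClosed-substPV (∃I n d)       kx (a , b)     k<p qu = a , HypClosed-substPV d kx b k<p qu
  HypClosed-substPV {u = u} (∃E d e) kx (a , b)   k<p qu = HypClosed-substPV d kx a k<p qu ,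
    HypClosed-substPV e (there (∋-map⁺ (renE suc) kx)) b (s≤s k<p)
                      (HypClosed-wkPV (renFO suc u) (HypClosed-wkFO u qu))
  HypClosed-substPV (H-ax s x)     kx q           k<p qu = q
  HypClosed-substPV {k = k} (W-ax {i = i} s x) kx (a , b) k<p qu =
    a , lowerIdx-< k i (∋-distinct x kx λ ()) b k<p
  HypClosed-substPV (H0-ax s x)    kx q           k<p qu = q
  HypClosed-substPV (H0-efq s)     kx q           k<p qu = q
  HypClosed-substPV (EM0 s d e)    kx (a , b)     k<p qu =
    HypClosed-substPV d (∋-++⁺ˡ kx) a k<p qu , HypClosed-substPV e (∋-++⁺ˡ kx) b k<p qu
  HypClosed-substPV {u = u} (EM1 s s' d e) kx (a , b) k<p qu =
    HypClosed-substPV d (there kx) a (s≤s k<p) (HypClosed-wkPV u qu) ,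
    HypClosed-substPV e (there kx) b (s≤s k<p) (HypClosed-wkPV u qu)

  HypClosed-exW : ∀ {Γ v A k m R p d} → Γ ⊢ v ⦂ A → Γ ∋ k ⦂ hyp (∃f R) →
                  HypClosed (suc p) d v → k < suc p → BoundT d m → HypClosed p d (exW k m v)
  HypClosed-exW {k = k} (ax {i = i} x) kx q k<p bm = lowerIdx-< k i (∋-distinct x kx λ ()) q k<p
  HypClosed-exW (∧I d e)       kx (a , b)     k<p bm = HypClosed-exW d kx a k<p bm , HypClosed-exW e kx b k<p bm
  HypClosed-exW (∧E₀ d)        kx q           k<p bm = HypClosed-exW d kx q k<p bm
  HypClosed-exW (∧E₁ d)        kx q           k<p bm = HypClosed-exW d kx q k<p bm
  HypClosed-exW (⇒E d e)       kx (a , b)     k<p bm = HypClosed-exW d kx a k<p bm , HypClosed-exW e kx b k<p bm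
  HypClosed-exW (⇒I d)         kx q           k<p bm = HypClosed-exW d (there kx) q (s≤s k<p) bm
  HypClosed-exW (∨I₀ d)        kx q           k<p bm = HypClosed-exW d kx q k<p bm
  HypClosed-exW (∨I₁ d)        kx q           k<p bm = HypClosed-exW d kx q k<p bm
  HypClosed-exW (∨E d e f)     kx (a , b , c) k<p bm = HypClosed-exW d kx a k<p bm ,
    HypClosed-exW e (there kx) b (s≤s k<p) bm , HypClosed-exW f (there kx) c (s≤s k<p) bm
  HypClosed-exW (∀E n d)       kx (a , b)     k<p bm = HypClosed-exW d kx a k<p bm , b
  HypClosed-exW {m = m} (∀I d) kx q           k<p bm =
    HypClosed-exW d (∋-map⁺ (renE suc) kx) q k<p (BoundT-wk m bm)
  HypClosed-exW (∃I n d)       kx (a , b)     k<p bm = a , HypClosed-exW d kx b k<p bm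
  HypClosed-exW {m = m} (∃E d e) kx (a , b)   k<p bm = HypClosed-exW d kx a k<p bm ,
    HypClosed-exW e (there (∋-map⁺ (renE suc) kx)) b (s≤s k<p) (BoundT-wk m bm)
  HypClosed-exW (H-ax s x)     kx q           k<p bm = q
  HypClosed-exW {k = k} {p = p} (W-ax {i = i} {P = P} s x) kx (a , b) k<p bm with look k i in eq
  ... | hit    = bm , BoundF-subF P a (BoundedSub-inst bm)
  ... | keep j = a , subst (_< p) (lowerIdx-keep k i eq) (lowerIdx-< k i (look-keep⇒≢ eq) b k<p)
  HypClosed-exW (H0-ax s x)    kx q           k<p bm = q
  HypClosed-exW (H0-efq s)     kx q           k<p bm = q
  HypClosed-exW (EM0 s d e)    kx (a , b)     k<p bm =
    HypClosed-exW d (∋-++⁺ˡ kx) a k<p bm , HypClosed-exW e (∋-++⁺ˡ kx) b k<p bm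
  HypClosed-exW (EM1 s s' d e) kx (a , b)     k<p bm =
    HypClosed-exW d (there kx) a (s≤s k<p) bm , HypClosed-exW e (there kx) b (s≤s k<p) bm

  HypClosed-ExH : ∀ {k m u u' p d} → ExH k m u u' → HypClosed p d u → HypClosed p d u'
  HypClosed-ExH (ex-hit {P = P})   (a , b)     = BoundF-subF P a (BoundedSub-inst b)
  HypClosed-ExH (ex-appₘ _ e)      (a , b)     = HypClosed-ExH e a , b
  HypClosed-ExH ex-pv              q           = q
  HypClosed-ExH (ex-app e e')      (a , b)     = HypClosed-ExH e a , HypClosed-ExH e' b
  HypClosed-ExH (ex-ƛ e)           q           = HypClosed-ExH e q
  HypClosed-ExH (ex-Λ e)           q           = HypClosed-ExH e q
  HypClosed-ExH (ex-⟨⟩ e e')       (a , b)     = HypClosed-ExH e a , HypClosed-ExH e' b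
  HypClosed-ExH (ex-π₀ e)          q           = HypClosed-ExH e q
  HypClosed-ExH (ex-π₁ e)          q           = HypClosed-ExH e q
  HypClosed-ExH (ex-ι₀ e)          q           = HypClosed-ExH e q
  HypClosed-ExH (ex-ι₁ e)          q           = HypClosed-ExH e q
  HypClosed-ExH (ex-case e e' e'') (a , b , c) = HypClosed-ExH e a , HypClosed-ExH e' b , HypClosed-ExH e'' c
  HypClosed-ExH (ex-pair e)        (a , b)     = a , HypClosed-ExH e b
  HypClosed-ExH (ex-unp e e')      (a , b)     = HypClosed-ExH e a , HypClosed-ExH e' b
  HypClosed-ExH (ex-em0 e e')      (a , b)     = HypClosed-ExH e a , HypClosed-ExH e' b
  HypClosed-ExH (ex-em1 e e')      (a , b)     = HypClosed-ExH e a , HypClosed-ExH e' b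
  HypClosed-ExH ex-Hyp             q           = q
  HypClosed-ExH ex-Wit             q           = q
  HypClosed-ExH ex-H0              q           = q

  ClosedT-wk⁻ : ∀ m → ClosedT (renT suc m) → ClosedT m
  ClosedT-wk⁻ m c n o = c (suc n) (occT-renT suc m n o)

  Active⇒ClosedT : ∀ k m t → Active k m t → ClosedT m
  Active⇒ClosedT k m (t · s)      (inj₁ a)                   = Active⇒ClosedT k m t a
  Active⇒ClosedT k m (t · s)      (inj₂ a)                   = Active⇒ClosedT k m s a
  Active⇒ClosedT k m (t ·ₘ n)     (inj₁ (_ , _ , refl , c , _)) = c
  Active⇒ClosedT k m (t ·ₘ n)     (inj₂ a)                   = Active⇒ClosedT k m t a
  Active⇒ClosedT k m (ƛ t)        a                          = Active⇒ClosedT (suc k) m t a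
  Active⇒ClosedT k m (Λ t)        a = ClosedT-wk⁻ m (Active⇒ClosedT k (renT suc m) t a)
  Active⇒ClosedT k m ⟨ t , s ⟩    (inj₁ a)                   = Active⇒ClosedT k m t a
  Active⇒ClosedT k m ⟨ t , s ⟩    (inj₂ a)                   = Active⇒ClosedT k m s a
  Active⇒ClosedT k m (π₀ t)       a                          = Active⇒ClosedT k m t a
  Active⇒ClosedT k m (π₁ t)       a                          = Active⇒ClosedT k m t a
  Active⇒ClosedT k m (ι₀ t)       a                          = Active⇒ClosedT k m t a
  Active⇒ClosedT k m (ι₁ t)       a                          = Active⇒ClosedT k m t a
  Active⇒ClosedT k m (case t s r) (inj₁ a)                   = Active⇒ClosedT k m t a
  Active⇒ClosedT k m (case t s r) (inj₂ (inj₁ a))            = Active⇒ClosedT (suc k) m s a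
  Active⇒ClosedT k m (case t s r) (inj₂ (inj₂ a))            = Active⇒ClosedT (suc k) m r a
  Active⇒ClosedT k m (pair n t)   a                          = Active⇒ClosedT k m t a
  Active⇒ClosedT k m (unpack t s) (inj₁ a)                   = Active⇒ClosedT k m t a
  Active⇒ClosedT k m (unpack t s) (inj₂ a) =
    ClosedT-wk⁻ m (Active⇒ClosedT (suc k) (renT suc m) s a)
  Active⇒ClosedT k m (em0 t s)    (inj₁ a)                   = Active⇒ClosedT k m t a
  Active⇒ClosedT k m (em0 t s)    (inj₂ a)                   = Active⇒ClosedT k m s a
  Active⇒ClosedT k m (em1 t s)    (inj₁ a)                   = Active⇒ClosedT (suc k) m t a
  Active⇒ClosedT k m (em1 t s)    (inj₂ a)                   = Active⇒ClosedT (suc k) m s a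

  ClosedT⇒BoundT : ∀ {d} m → ClosedT m → BoundT d m
  ClosedT⇒BoundT m c n o = ⊥-elim (c n o)

  HypClosed-⟶ : ∀ {Γ t t' A p d} → t ⟶ t' → Γ ⊢ t ⦂ A → HypClosed p d t → HypClosed p d t'
  HypClosed-⟶ β-ƛ  (⇒E (⇒I d) e)    (a , b)     = HypClosed-substPV d here a (s≤s z≤n) b
  HypClosed-⟶ (β-Λ {u = u}) (∀E m (∀I d)) (a , b) = HypClosed-subFO (m • var) u a (BoundedSub-inst b)
  HypClosed-⟶ β-π₀ (∧E₀ (∧I d e))   (a , b)     = a
  HypClosed-⟶ β-π₁ (∧E₁ (∧I d e))   (a , b)     = b
  HypClosed-⟶ β-ι₀ (∨E (∨I₀ d) e f) (a , b , c) = HypClosed-substPV e here b (s≤s z≤n) a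
  HypClosed-⟶ β-ι₁ (∨E (∨I₁ d) e f) (a , b , c) = HypClosed-substPV f here c (s≤s z≤n) a
  HypClosed-⟶ (β-∃ {v = v}) (∃E {C = C} (∃I m d) e) ((bm , qu) , qv) =
    HypClosed-substPV (⊢-cast (cong (_ ∷_) (inst-⇑ m _)) (inst-wk m C) (⊢-subFO (m • var) e)) here
                      (HypClosed-subFO (m • var) v qv (BoundedSub-inst bm)) (s≤s z≤n) qu
  HypClosed-⟶ p-app    _ ((a , b) , c) = (a , c) , (b , c)
  HypClosed-⟶ p-appₘ   _ ((a , b) , c) = (a , c) , (b , c)
  HypClosed-⟶ p-π₀     _ q             = q
  HypClosed-⟶ p-π₁     _ q             = q
  HypClosed-⟶ p-case   _ ((a , b) , c) = (a , c) , (b , c)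
  HypClosed-⟶ p-unpack _ ((a , b) , c) = (a , c) , (b , c)
  HypClosed-⟶ (em1-drop {u = u} 0∉u) _ (a , b) = HypClosed-renPV pred u a pred<
    where
    pred< : ∀ i → Free i u → i < suc _ → pred i < _
    pred< zero    0∈u _         = ⊥-elim (0∉u 0∈u)
    pred< (suc i) _   (s≤s i<p) = i<p
  HypClosed-⟶ (em1-exc {u = u} {m = m} act ex) (EM1 s s' d e) (a , b) =
    HypClosed-exW e here b (s≤s z≤n) (ClosedT⇒BoundT m (Active⇒ClosedT 0 m u act)) ,
    HypClosed-ExH ex a , b

  HypClosed-↦ : ∀ {Γ t t' A p d} → t ↦ t' → Γ ⊢ t ⦂ A → HypClosed p d t → HypClosed p d t'
  HypClosed-↦ (top r)    d              q           = HypClosed-⟶ r d q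
  HypClosed-↦ (app₁ r)   (⇒E d e)       (a , b)     = HypClosed-↦ r d a , b
  HypClosed-↦ (app₂ r)   (⇒E d e)       (a , b)     = a , HypClosed-↦ r e b
  HypClosed-↦ (appₘ r)   (∀E m d)       (a , b)     = HypClosed-↦ r d a , b
  HypClosed-↦ (ƛ-c r)    (⇒I d)         q           = HypClosed-↦ r d q
  HypClosed-↦ (Λ-c r)    (∀I d)         q           = HypClosed-↦ r d q
  HypClosed-↦ (⟨⟩₁ r)    (∧I d e)       (a , b)     = HypClosed-↦ r d a , b
  HypClosed-↦ (⟨⟩₂ r)    (∧I d e)       (a , b)     = a , HypClosed-↦ r e b
  HypClosed-↦ (π₀-c r)   (∧E₀ d)        q           = HypClosed-↦ r d q
  HypClosed-↦ (π₁-c r)   (∧E₁ d)        q           = HypClosed-↦ r d q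
  HypClosed-↦ (ι₀-c r)   (∨I₀ d)        q           = HypClosed-↦ r d q
  HypClosed-↦ (ι₁-c r)   (∨I₁ d)        q           = HypClosed-↦ r d q
  HypClosed-↦ (case₁ r)  (∨E d e f)     (a , b , c) = HypClosed-↦ r d a , b , c
  HypClosed-↦ (case₂ r)  (∨E d e f)     (a , b , c) = a , HypClosed-↦ r e b , c
  HypClosed-↦ (case₃ r)  (∨E d e f)     (a , b , c) = a , b , HypClosed-↦ r f c
  HypClosed-↦ (pair-c r) (∃I m d)       (a , b)     = a , HypClosed-↦ r d b
  HypClosed-↦ (unp₁ r)   (∃E d e)       (a , b)     = HypClosed-↦ r d a , b
  HypClosed-↦ (unp₂ r)   (∃E d e)       (a , b)     = a , HypClosed-↦ r e b
  HypClosed-↦ (em0₁ r)   (EM0 s d e)    (a , b)     = HypClosed-↦ r d a , b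
  HypClosed-↦ (em0₂ r)   (EM0 s d e)    (a , b)     = a , HypClosed-↦ r e b
  HypClosed-↦ (em1₁ r)   (EM1 s s' d e) (a , b)     = HypClosed-↦ r d a , b
  HypClosed-↦ (em1₂ r)   (EM1 s s' d e) (a , b)     = a , HypClosed-↦ r e b

  HypClosed-↦* : ∀ {Γ t t' A p d} → t ↦* t' → Γ ⊢ t ⦂ A → HypClosed p d t → HypClosed p d t'
  HypClosed-↦* ε        d q = q
  HypClosed-↦* (r ◅ rs) d q = HypClosed-↦* rs (subject-reduction r d) (HypClosed-↦ r d q)

  -- Normal forms

  -- The side condition of ExH compares first-order terms, whose equality is
  -- undecidable for an arbitrary signature; so ExH is total only up to double
  -- negation, which suffices because normality is a negative statement.
  ExH-total : ∀ k m t → ¬ ¬ Σ PT (ExH k m t)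
  ExH-total k m (pv i)       c = c (_ , ex-pv)
  ExH-total k m (t · s)      c =
    ExH-total k m t λ (_ , e) → ExH-total k m s λ (_ , e') → c (_ , ex-app e e')
  ExH-total k m (t ·ₘ n)     c = ¬¬-excluded-middle {A = Σ Fm λ P → t ≡ Hyp k P × n ≡ m} λ where
    (yes (_ , refl , refl)) → c (_ , ex-hit)
    (no ¬hit)               →
      ExH-total k m t λ (_ , e) → c (_ , ex-appₘ (λ P t≡ n≡ → ¬hit (P , t≡ , n≡)) e)
  ExH-total k m (ƛ t)        c = ExH-total (suc k) m t λ (_ , e) → c (_ , ex-ƛ e)
  ExH-total k m (Λ t)        c = ExH-total k (renT suc m) t λ (_ , e) → c (_ , ex-Λ e)
  ExH-total k m ⟨ t , s ⟩    c =
    ExH-total k m t λ (_ , e) → ExH-total k m s λ (_ , e') → c (_ , ex-⟨⟩ e e')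
  ExH-total k m (π₀ t)       c = ExH-total k m t λ (_ , e) → c (_ , ex-π₀ e)
  ExH-total k m (π₁ t)       c = ExH-total k m t λ (_ , e) → c (_ , ex-π₁ e)
  ExH-total k m (ι₀ t)       c = ExH-total k m t λ (_ , e) → c (_ , ex-ι₀ e)
  ExH-total k m (ι₁ t)       c = ExH-total k m t λ (_ , e) → c (_ , ex-ι₁ e)
  ExH-total k m (case t s r) c =
    ExH-total k m t λ (_ , e) → ExH-total (suc k) m s λ (_ , e') →
    ExH-total (suc k) m r λ (_ , e'') → c (_ , ex-case e e' e'')
  ExH-total k m (pair n t)   c = ExH-total k m t λ (_ , e) → c (_ , ex-pair e)
  ExH-total k m (unpack t s) c =
    ExH-total k m t λ (_ , e) → ExH-total (suc k) (renT suc m) s λ (_ , e') → c (_ , ex-unp e e')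
  ExH-total k m (em0 t s)    c =
    ExH-total k m t λ (_ , e) → ExH-total k m s λ (_ , e') → c (_ , ex-em0 e e')
  ExH-total k m (em1 t s)    c =
    ExH-total (suc k) m t λ (_ , e) → ExH-total (suc k) m s λ (_ , e') → c (_ , ex-em1 e e')
  ExH-total k m (Hyp i A)    c = c (_ , ex-Hyp)
  ExH-total k m (Wit i P)    c = c (_ , ex-Wit)
  ExH-total k m (H0 P)       c = c (_ , ex-H0)

  normal-under : ∀ {t s} {f : PT → PT} → (∀ {t'} → t ↦ t' → s ↦ f t') → Normal s → Normal t
  normal-under step nf _ r = nf _ (step r)

  Neutral : PT → Set
  Neutral (pv _)       = ⊤
  Neutral (_ · _)      = ⊤
  Neutral (_ ·ₘ _)     = ⊤
  Neutral (π₀ _)       = ⊤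
  Neutral (π₁ _)       = ⊤
  Neutral (case _ _ _) = ⊤
  Neutral (unpack _ _) = ⊤
  Neutral (Hyp _ _)    = ⊤
  Neutral (Wit _ _)    = ⊤
  Neutral (H0 _)       = ⊤
  Neutral _            = ⊥

  data HeadForm : PT → Fm → Set where
    neutral   : ∀ {t A} → Neutral t → HeadForm t A
    ƛ-form    : ∀ {u A B} → HeadForm (ƛ u) (A ⇒f B)
    Λ-form    : ∀ {u A} → HeadForm (Λ u) (∀f A)
    ⟨⟩-form   : ∀ {u v A B} → HeadForm ⟨ u , v ⟩ (A ∧f B)
    ι₀-form   : ∀ {u A B} → HeadForm (ι₀ u) (A ∨f B)
    ι₁-form   : ∀ {u A B} → HeadForm (ι₁ u) (A ∨f B)
    pair-form : ∀ {m u A} → HeadForm (pair m u) (∃f A)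
    em0-form  : ∀ {u v C} → HeadForm (em0 u v) C
    em1-form  : ∀ {u v A} → HeadForm (em1 u v) (∃f A)

  headForm : ∀ {Γ t A} → Γ ⊢ t ⦂ A → HeadForm t A
  headForm (ax _)          = neutral tt
  headForm (∧I _ _)        = ⟨⟩-form
  headForm (∧E₀ _)         = neutral tt
  headForm (∧E₁ _)         = neutral tt
  headForm (⇒E _ _)        = neutral tt
  headForm (⇒I _)          = ƛ-form
  headForm (∨I₀ _)         = ι₀-form
  headForm (∨I₁ _)         = ι₁-form
  headForm (∨E _ _ _)      = neutral tt
  headForm (∀E _ _)        = neutral tt
  headForm (∀I _)          = Λ-form
  headForm (∃I _ _)        = pair-form
  headForm (∃E _ _)        = neutral tt
  headForm (H-ax _ _)      = neutral tt
  headForm (W-ax _ _)      = neutral tt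
  headForm (H0-ax _ _)     = neutral tt
  headForm (H0-efq _)      = neutral tt
  headForm (EM0 _ _ _)     = em0-form
  headForm (EM1 _ _ _ _)   = em1-form

  Neutral-head-· : ∀ {Γ t s A B} → Normal (t · s) → Γ ⊢ t ⦂ A ⇒f B → Neutral t
  Neutral-head-· nf d with headForm d
  ... | neutral n = n
  ... | ƛ-form    = ⊥-elim (nf _ (top β-ƛ))
  ... | em0-form  = ⊥-elim (nf _ (top p-app))

  Neutral-head-·ₘ : ∀ {Γ t m A} → Normal (t ·ₘ m) → Γ ⊢ t ⦂ ∀f A → Neutral t
  Neutral-head-·ₘ nf d with headForm d
  ... | neutral n = n
  ... | Λ-form    = ⊥-elim (nf _ (top β-Λ))
  ... | em0-form  = ⊥-elim (nf _ (top p-appₘ))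

  Neutral-head-π₀ : ∀ {Γ t A B} → Normal (π₀ t) → Γ ⊢ t ⦂ A ∧f B → Neutral t
  Neutral-head-π₀ nf d with headForm d
  ... | neutral n = n
  ... | ⟨⟩-form   = ⊥-elim (nf _ (top β-π₀))
  ... | em0-form  = ⊥-elim (nf _ (top p-π₀))

  Neutral-head-π₁ : ∀ {Γ t A B} → Normal (π₁ t) → Γ ⊢ t ⦂ A ∧f B → Neutral t
  Neutral-head-π₁ nf d with headForm d
  ... | neutral n = n
  ... | ⟨⟩-form   = ⊥-elim (nf _ (top β-π₁))
  ... | em0-form  = ⊥-elim (nf _ (top p-π₁))

  Neutral-head-case : ∀ {Γ t s r A B} → Normal (case t s r) → Γ ⊢ t ⦂ A ∨f B → Neutral t
  Neutral-head-case nf d with headForm d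
  ... | neutral n = n
  ... | ι₀-form   = ⊥-elim (nf _ (top β-ι₀))
  ... | ι₁-form   = ⊥-elim (nf _ (top β-ι₁))
  ... | em0-form  = ⊥-elim (nf _ (top p-case))

  -- The p innermost entries of Γ, which are those a term satisfying
  -- HypClosed p may refer to by pv or W, are negative proof variables or
  -- ∀-hypotheses.
  record LocalsNegative (p : ℕ) (Γ : Ctx) : Set where
    field
      prf-negative : ∀ {i A} → i < p → Γ ∋ i ⦂ prf A → NegProp A
      no-∃-hyp     : ∀ {i A} → i < p → ¬ Γ ∋ i ⦂ hyp (∃f A)
  open LocalsNegative

  LocalsNegative-zero : ∀ {Γ} → LocalsNegative 0 Γ
  LocalsNegative-zero = record { prf-negative = λ () ; no-∃-hyp = λ () }

  LocalsNegative-prf : ∀ {p Γ A} → NegProp A → LocalsNegative p Γ → LocalsNegative (suc p) (prf A ∷ Γ)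
  LocalsNegative-prf a g = record
    { prf-negative = λ { _ here → a ; (s≤s i<p) (there x) → prf-negative g i<p x }
    ; no-∃-hyp     = λ { (s≤s i<p) (there x) → no-∃-hyp g i<p x } }

  LocalsNegative-∀hyp : ∀ {p Γ P} → LocalsNegative p Γ → LocalsNegative (suc p) (hyp (∀f P) ∷ Γ)
  LocalsNegative-∀hyp g = record
    { prf-negative = λ { (s≤s i<p) (there x) → prf-negative g i<p x }
    ; no-∃-hyp     = λ { (s≤s i<p) (there x) → no-∃-hyp g i<p x } }

  LocalsNegative-∷ʳ : ∀ {p Γ P} → NegProp P → LocalsNegative p Γ → LocalsNegative p (Γ ++ [ hyp P ])
  LocalsNegative-∷ʳ a g = record
    { prf-negative = λ i<p x → case ∋-∷ʳ⁻ x of λ { (inj₁ y) → prf-negative g i<p y }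
    ; no-∃-hyp     = λ i<p x → case ∋-∷ʳ⁻ x of λ { (inj₁ y) → no-∃-hyp g i<p y
                                                  ; (inj₂ refl) → ¬NegProp-∃ a } }

  HypsActive : Ctx → PT → Set
  HypsActive Γ t = ∀ {k P} → Γ ∋ k ⦂ hyp (∀f P) → Free k t → Σ Tm λ m → Active k m t

  HypsActiveOrHead : Ctx → PT → Fm → Set
  HypsActiveOrHead Γ t T = ∀ {k P} → Γ ∋ k ⦂ hyp (∀f P) → Free k t →
                           (Σ Tm λ m → Active k m t) ⊎ (Σ Fm λ P' → t ≡ Hyp k P' × T ≡ ∀f P')

  HypsActive⇒OrHead : ∀ {Γ t T} → HypsActive Γ t → HypsActiveOrHead Γ t T
  HypsActive⇒OrHead h kx = inj₁ ∘ h kx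

  HypsActiveOrHead⇒HypsActive : ∀ {Γ t T} → (∀ {P} → T ≢ ∀f P) → HypsActiveOrHead Γ t T →
                                HypsActive Γ t
  HypsActiveOrHead⇒HypsActive T≢∀ h kx f with h kx f
  ... | inj₁ a               = a
  ... | inj₂ (_ , _ , T≡∀P) = ⊥-elim (T≢∀ T≡∀P)

  HypsActive-∀E : ∀ {p Γ t A m} → BoundT 0 m → HypClosed p 0 t →
                  HypsActiveOrHead Γ t (∀f A) → HypsActive Γ (t ·ₘ m)
  HypsActive-∀E {m = m} bm q h kx f with h kx f
  ... | inj₁ (m' , a)          = m' , inj₂ a
  ... | inj₂ (P , refl , refl) = m , inj₁ (P , refl , refl , closed , only-α)
    where
    closed : ClosedT m
    closed n o with () ← bm n o
    only-α : ∀ j → occF j P → j ≡ 0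
    only-α j o with s≤s z≤n ← q j o = refl

  ¬SimplyUniversal-∃ : ∀ {A} → ¬ SimplyUniversal (∃f A)
  ¬SimplyUniversal-∃ (su-base ())

  ¬SimplyUniversal-∨ : ∀ {A B} → ¬ SimplyUniversal (A ∨f B)
  ¬SimplyUniversal-∨ (su-base ())

  mutual
    neutral-normal : ∀ {p Γ t T} → LocalsNegative p Γ → HypClosed p 0 t → Normal t →
                     Γ ⊢ t ⦂ T → Neutral t → SimplyUniversal T × HypsActiveOrHead Γ t T
    neutral-normal g q       nf (ax x)      _ =
      su-base (prf-negative g q x) , λ kx i≡k → ⊥-elim (∋-distinct x kx (λ ()) i≡k)
    neutral-normal g q       nf (H-ax s x)  _ = su-∀ s , λ { kx refl → inj₂ (_ , refl , refl) }
    neutral-normal g (_ , i<p) nf (W-ax s x) _ = ⊥-elim (no-∃-hyp g i<p x)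
    neutral-normal g q       nf (H0-ax s x) _ = su-base s , λ _ ()
    neutral-normal g q       nf (H0-efq s)  _ = su-base (np-⇒ np-⊥ s) , λ _ ()
    neutral-normal g q       nf (∧E₀ d)     _
      with neutral-normal g q (normal-under π₀-c nf) d (Neutral-head-π₀ nf d)
    ... | su-base (np-∧ a _) , h = su-base a , HypsActive⇒OrHead (HypsActiveOrHead⇒HypsActive (λ ()) h)
    neutral-normal g q       nf (∧E₁ d)     _
      with neutral-normal g q (normal-under π₁-c nf) d (Neutral-head-π₁ nf d)
    ... | su-base (np-∧ _ b) , h = su-base b , HypsActive⇒OrHead (HypsActiveOrHead⇒HypsActive (λ ()) h)
    neutral-normal g (q₁ , q₂) nf (⇒E d e)  _
      with neutral-normal g q₁ (normal-under app₁ nf) d (Neutral-head-· nf d)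
    ... | su-base (np-⇒ a b) , h = su-base b , HypsActive⇒OrHead λ kx → Sum.[
            map₂ inj₁ ∘ HypsActiveOrHead⇒HypsActive (λ ()) h kx ,
            map₂ inj₂ ∘ negative-normal g q₂ (normal-under app₂ nf) e a kx ]
    neutral-normal g (q₁ , bm) nf (∀E m d)  _
      with neutral-normal g q₁ (normal-under appₘ nf) d (Neutral-head-·ₘ nf d)
    ... | su-base () , _
    ... | su-∀ s , h = SimplyUniversal-subF _ s , HypsActive⇒OrHead (HypsActive-∀E bm q₁ h)
    neutral-normal g (q₁ , _) nf (∨E d _ _) _
      with neutral-normal g q₁ (normal-under case₁ nf) d (Neutral-head-case nf d)
    ... | su , _ = ⊥-elim (¬SimplyUniversal-∨ su)
    neutral-normal g (q₁ , _) nf (∃E d _) _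
      with proj₁ (exists-normal g q₁ (normal-under unp₁ nf) d)
    ... | hnf-pair _  = ⊥-elim (nf _ (top β-∃))
    ... | hnf-em0 _ _ = ⊥-elim (nf _ (top p-unpack))

    negative-normal : ∀ {p Γ t T} → LocalsNegative p Γ → HypClosed p 0 t → Normal t →
                      Γ ⊢ t ⦂ T → NegProp T → HypsActive Γ t
    negative-normal g q nf d a with headForm d
    ... | neutral n =
      HypsActiveOrHead⇒HypsActive (λ { refl → ¬NegProp-∀ a }) (proj₂ (neutral-normal g q nf d n))
    negative-normal g (q₁ , q₂) nf (∧I d e) (np-∧ a b) | ⟨⟩-form = λ kx → Sum.[
      map₂ inj₁ ∘ negative-normal g q₁ (normal-under ⟨⟩₁ nf) d a kx ,
      map₂ inj₂ ∘ negative-normal g q₂ (normal-under ⟨⟩₂ nf) e b kx ]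
    negative-normal g q nf (⇒I d) (np-⇒ a b) | ƛ-form =
      negative-normal (LocalsNegative-prf a g) q (normal-under ƛ-c nf) d b ∘ there
    negative-normal g (q₁ , q₂) nf (EM0 s d e) c | em0-form =
      λ kx → Sum.[ map₂ inj₁ ∘ left (∋-++⁺ˡ kx) , map₂ inj₂ ∘ right (∋-++⁺ˡ kx) ]
      where
      left  = negative-normal (LocalsNegative-∷ʳ (np-⇒ s np-⊥) g) q₁ (normal-under em0₁ nf) d c
      right = negative-normal (LocalsNegative-∷ʳ s g) q₂ (normal-under em0₂ nf) e c

    exists-normal : ∀ {p Γ t A} → LocalsNegative p Γ → HypClosed p 0 t → Normal t →
                    Γ ⊢ t ⦂ ∃f A → HerbrandNF t × (NegProp A → HypsActive Γ t)
    exists-normal g q nf d with headForm d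
    ... | neutral n = ⊥-elim (¬SimplyUniversal-∃ (proj₁ (neutral-normal g q nf d n)))
    exists-normal g (_ , q) nf (∃I m d) | pair-form =
      hnf-pair nf , λ a → negative-normal g q (normal-under pair-c nf) d (NegProp-subF _ a)
    exists-normal g (q₁ , q₂) nf (EM0 s d e) | em0-form =
      hnf-em0 (proj₁ left) (proj₁ right) , λ a kx → Sum.[
        map₂ inj₁ ∘ proj₂ left a (∋-++⁺ˡ kx) , map₂ inj₂ ∘ proj₂ right a (∋-++⁺ˡ kx) ]
      where
      left  = exists-normal (LocalsNegative-∷ʳ (np-⇒ s np-⊥) g) q₁ (normal-under em0₁ nf) d
      right = exists-normal (LocalsNegative-∷ʳ s g) q₂ (normal-under em0₂ nf) e
    exists-normal g (q₁ , _) nf (EM1 {u = u} _ b d _) | em1-form = ⊥-elim (nf _ (top (em1-drop a∉u)))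
      where
      a∉u : ¬ Free 0 u
      a∉u a∈u
        with m , act ← proj₂ (exists-normal (LocalsNegative-∀hyp g) q₁ (normal-under em1₁ nf) d) b here a∈u
        = ExH-total 0 m u λ (_ , ex) → nf _ (top (em1-exc act ex))

  -- Herbrand disjunctions

  data NonEmpty {X : Set} : List X → Set where
    nonEmpty : ∀ {x xs} → NonEmpty (x ∷ xs)

  NonEmpty-map : ∀ {X Y : Set} (f : X → Y) {xs} → NonEmpty xs → NonEmpty (map f xs)
  NonEmpty-map f nonEmpty = nonEmpty

  NonEmpty-++ : ∀ {X : Set} {xs ys : List X} → NonEmpty xs → NonEmpty (xs ++ ys)
  NonEmpty-++ nonEmpty = nonEmpty

  witnesses-NonEmpty : ∀ {t} → HerbrandNF t → NonEmpty (witnesses t)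
  witnesses-NonEmpty (hnf-pair _)  = nonEmpty
  witnesses-NonEmpty (hnf-em0 h _) = NonEmpty-++ (witnesses-NonEmpty h)

  ⋁-++⁺ˡ : ∀ {Γ w} As {Bs} → NonEmpty As → NonEmpty Bs → Γ ⊢ w ⦂ ⋁ As →
           Σ PT λ w' → Γ ⊢ w' ⦂ ⋁ (As ++ Bs)
  ⋁-++⁺ˡ (A ∷ [])      _ nonEmpty d = _ , ∨I₀ d
  ⋁-++⁺ˡ (A ∷ A' ∷ As) _ ne       d =
    _ , ∨E d (∨I₀ (ax here)) (∨I₁ (proj₂ (⋁-++⁺ˡ (A' ∷ As) nonEmpty ne (ax here))))

  ⋁-++⁺ʳ : ∀ {Γ w} As {Bs} → NonEmpty As → NonEmpty Bs → Γ ⊢ w ⦂ ⋁ Bs →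
           Σ PT λ w' → Γ ⊢ w' ⦂ ⋁ (As ++ Bs)
  ⋁-++⁺ʳ (A ∷ [])      _ nonEmpty d = _ , ∨I₁ d
  ⋁-++⁺ʳ (A ∷ A' ∷ As) _ ne       d = _ , ∨I₁ (proj₂ (⋁-++⁺ʳ (A' ∷ As) nonEmpty ne d))

  HerbrandNF-⋁ : ∀ {Γ t A} → Γ ⊢ t ⦂ ∃f A → HerbrandNF t →
                 Σ PT λ w → Γ ⊢ w ⦂ ⋁ (map (λ m → A [ m ]F) (witnesses t))
  HerbrandNF-⋁ (∃I m d) (hnf-pair _) = _ , d
  HerbrandNF-⋁ {Γ} {A = A} (EM0 {u = u} {v = v} s d e) (hnf-em0 h h') =
    _ , subst (λ As → Γ ⊢ em0 (proj₁ left) (proj₁ right) ⦂ ⋁ As)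
              (sym (map-++ inst (witnesses u) (witnesses v)))
              (EM0 s (proj₂ left) (proj₂ right))
    where
    inst : Tm → Fm
    inst m = A [ m ]F
    ne   = NonEmpty-map inst (witnesses-NonEmpty h)
    ne'  = NonEmpty-map inst (witnesses-NonEmpty h')
    left  = ⋁-++⁺ˡ (map inst (witnesses u)) ne ne' (proj₂ (HerbrandNF-⋁ d h))
    right = ⋁-++⁺ʳ (map inst (witnesses u)) ne ne' (proj₂ (HerbrandNF-⋁ e h'))

theorem3p11 : (L : Signature) (let open Syntax L) →
    (Γ : Ctx) (A : Fm) (t t' : PT) →
    ClosedF (∃f A) →
    Γ ⊢ t ⦂ ∃f A →
    QuasiClosed t →
    t ↦* t' →
    Normal t' →
    (Γ ⊢ t' ⦂ ∃f A) × HerbrandNF t' ×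
      Σ PT (λ w → Γ ⊢ w ⦂ ⋁ (map (λ m → A [ m ]F) (witnesses t')))
theorem3p11 L Γ A t t' _ ⊢t quasiClosed t↦*t' normal = ⊢t' , herbrand , HerbrandNF-⋁ L ⊢t' herbrand
  where
  open Syntax L
  ⊢t' : Γ ⊢ t' ⦂ ∃f A
  ⊢t' = subject-reduction* L t↦*t' ⊢t
  hypClosed : HypClosed L 0 0 t'
  hypClosed = HypClosed-↦* L t↦*t' ⊢t (QC⇒HypClosed L 0 0 t quasiClosed)
  herbrand : HerbrandNF t'
  herbrand = proj₁ (exists-normal L (LocalsNegative-zero L) hypClosed normal ⊢t')
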